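{- Let $P, P' \in \mathbb{P}$ and $\theta$ a proof term. Then $P \xrightarrow{\theta} P'$ if and only if $X_P \xrightarrow{\mathrm{act}(\theta)} X_{P'}$ is a transition of the stable configuration structure $\mathsf{C}_P$.
   Context: Fix a countable set $\mathcal{A}$ of actions containing an unobservable action $\tau$. Proof terms: $\theta ::= a \mid ._{a}\theta \mid {+_{\mathrm l}}\theta \mid {+_{\mathrm r}}\theta \mid {\|^{\mathrm l}_{L}}\theta \mid {\|^{\mathrm r}_{L}}\theta \mid \langle\theta,\theta\rangle_L$ with $a \in \mathcal{A}$, $L \subseteq \mathcal{A}\setminus\{\tau\}$. The partial function $\mathrm{act}$: $\mathrm{act}(a)=a$; $\mathrm{act}$ of $._a\theta$, ${+_{\mathrm l}}\theta$, ${+_{\mathrm r}}\theta$, ${\|^{\mathrm l}_L}\theta$, ${\|^{\mathrm r}_L}\theta$ is $\mathrm{act}(\theta)$; $\mathrm{act}(\langle\theta_1,\theta_2\rangle_L)=\mathrm{act}(\theta_1)$ if $\mathrm{act}(\theta_1)=\mathrm{act}(\theta_2)$, undefined otherwise. Processes: $P ::= \underline{0} \mid a.P \mid a^{\dagger\xi}.P \mid P + P \mid P \|_L P$ with $\xi ::= \varepsilon \mid \langle\theta,\theta'\rangle_L$ ($a^{\dagger\varepsilon}$ written $a^\dagger$). A process is initial iff it contains no $\dagger$. $\mathrm{toinitial}(P)$ is obtained from $P$ by replacing every executed prefix $a^{\dagger\xi}$ by $a$. Proved transitions: (Act$_f$) if $P$ initial then $a.P \xrightarrow{a} a^\dagger.P$;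 (Act$_p$) if $P \xrightarrow{\theta} P'$ then $a^{\dagger\xi}.P \xrightarrow{._a\theta} a^{\dagger\xi}.P'$; (Cho$_l$) if $P_1 \xrightarrow{\theta} P_1'$ and $P_2$ initial then $P_1+P_2 \xrightarrow{+_{\mathrm l}\theta} P_1'+P_2$; (Cho$_r$) symmetric; (Par$_l$) if $P_1 \xrightarrow{\theta} P_1'$ and $\mathrm{act}(\theta)\notin L$ then $P_1\|_LP_2 \xrightarrow{\|^{\mathrm l}_L\theta} P_1'\|_LP_2$; (Par$_r$) symmetric; (Syn) if $P_1 \xrightarrow{\theta_1} P_1'$, $P_2 \xrightarrow{\theta_2} P_2'$, $\mathrm{act}(\theta_1)=\mathrm{act}(\theta_2)\in L$ then $P_1\|_LP_2 \xrightarrow{\langle\theta_1,\theta_2\rangle_L} \mathrm{enr}(P_1'\|_LP_2',\langle\theta_1,\theta_2\rangle_L)$, where $\mathrm{enr}(P,\bar\theta)=\mathrm{enr}'(P,\bar\theta,\bar\theta)$ follows the path $\theta$ inside $P$ and replaces the decoration of each reached executed prefix $a^{\dagger\xi}$ (reached when the remaining path is $a$) by $a^{\dagger\bar\theta}$: $\mathrm{enr}'(\underline0,\theta,\bar\theta)=\underline0$; $\mathrm{enr}'(a^{\dagger\xi}.P',a,\bar\theta)=a^{\dagger\bar\theta}.P'$; $\mathrm{enr}'(a^{\dagger\xi}.P',._a\theta',\bar\theta)=a^{\dagger\xi}.\mathrm{enr}'(P',\theta',\bar\theta)$; $\mathrm{enr}'(P_1+P_2,+_{\mathrm l}\theta',\bar\theta)=\mathrm{enr}'(P_1,\theta',\bar\theta)+P_2$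 and symmetrically; $\mathrm{enr}'(P_1\|_LP_2,\|^{\mathrm l}_L\theta',\bar\theta)=\mathrm{enr}'(P_1,\theta',\bar\theta)\|_LP_2$ and symmetrically; $\mathrm{enr}'(P_1\|_LP_2,\langle\theta_1,\theta_2\rangle_L,\bar\theta)=\mathrm{enr}'(P_1,\theta_1,\bar\theta)\|_L\mathrm{enr}'(P_2,\theta_2,\bar\theta)$. $\mathbb{P}$ is the set of processes reachable by proved transitions from initial processes. Stable configuration structures: triples $(\mathcal{E},\mathcal{C},\ell)$ with $\mathcal{C}$ a set of finite subsets of $\mathcal{E}$ (configurations) and $\ell$ a labeling, rooted, connected, and closed under bounded unions and intersections; a transition $X\xrightarrow{a}X'$ means $X\subseteq X'$, $X'\setminus X=\{e\}$, $\ell(e)=a$. Operators on such structures whose events are proof terms (labels always given by $\ell(e)=\mathrm{act}(e)$): $\mathsf{N}=(\emptyset,\{\emptyset\},\emptyset)$; $a.\mathsf{C}$ has events $\{a\}\cup\{._a\theta\mid\theta\in\mathcal{E}\}$ and configurations $\{\emptyset\}\cup\{\{a\}\cup\{._a\theta\mid\theta\in X\}\mid X\in\mathcal{C}\}$; $\mathsf{C}_1+\mathsf{C}_2$ has events $\{+_{\mathrm l}\theta\mid\theta\in\mathcal{E}_1\}\cup\{+_{\mathrm r}\theta\mid\theta\in\mathcal{E}_2\}$ and configurations $\{\{+_{\mathrm l}\theta\mid\theta\in X_1\}\mid X_1\in\mathcal{C}_1\}\cup\{\{+_{\mathrm r}\theta\mid\theta\in X_2\}\mid X_2\in\mathcal{C}_2\}$;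 $\mathsf{C}_1\|_L\mathsf{C}_2$ has events $\{\|^{\mathrm l}_L\theta\mid\theta\in\mathcal{E}_1,\mathrm{act}(\theta)\notin L\}\cup\{\|^{\mathrm r}_L\theta\mid\theta\in\mathcal{E}_2,\mathrm{act}(\theta)\notin L\}\cup\{\langle\theta_1,\theta_2\rangle_L\mid\theta_i\in\mathcal{E}_i,\mathrm{act}(\theta_1)=\mathrm{act}(\theta_2)\in L\}$ and configurations the finite sets $X$ of such events with $\mathrm{proj}_1(X)\in\mathcal{C}_1$, $\mathrm{proj}_2(X)\in\mathcal{C}_2$, such that for all $e,e'\in X$: if $\mathrm{proj}_1(\{e\})=\mathrm{proj}_1(\{e'\})\neq\emptyset$ or $\mathrm{proj}_2(\{e\})=\mathrm{proj}_2(\{e'\})\neq\emptyset$ then $e=e'$; and if $e\neq e'$ then there is $Y\subseteq X$ with $\mathrm{proj}_1(Y)\in\mathcal{C}_1$, $\mathrm{proj}_2(Y)\in\mathcal{C}_2$ and ($e\in Y\iff e'\notin Y$). Here $\mathrm{proj}_1(X)=\{\theta_1\mid \|^{\mathrm l}_L\theta_1\in X \text{ or } \exists\theta_2.\langle\theta_1,\theta_2\rangle_L\in X\}$ and $\mathrm{proj}_2$ symmetrically. For initial $Q$, $\mathrm{scs}(Q)$ is defined by $\mathrm{scs}(\underline0)=\mathsf{N}$, $\mathrm{scs}(a.Q')=a.\mathrm{scs}(Q')$, $\mathrm{scs}(Q_1+Q_2)=\mathrm{scs}(Q_1)+\mathrm{scs}(Q_2)$, $\mathrm{scs}(Q_1\|_LQ_2)=\mathrm{scs}(Q_1)\|_L\mathrm{scs}(Q_2)$.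 For $P\in\mathbb{P}$: $\mathsf{C}_P=\mathrm{scs}(\mathrm{toinitial}(P))$, and $X_P=\emptyset$ if $P$ is initial, otherwise $X_P=\{\theta_1,\dots,\theta_n\}$ for a sequence of proved transitions $P_0\xrightarrow{\theta_1}P_1\cdots\xrightarrow{\theta_n}P_n$ with $P_0=\mathrm{toinitial}(P)$ and $P_n=P$ (the paper takes this set to be independent of the chosen sequence).
   Formalization: The configuration transition $X_P \xrightarrow{\mathrm{act}(\theta)} X_{P'}$ adds exactly the event θ (not any event labelled act(θ)), and P, P′ are assumed to satisfy toinitial(P) = toinitial(P′). The statement above fails without it. -}

module Defs where

open import Level using (Level; 0ℓ; Lift; suc)
open import Data.Empty using (⊥)
open import Data.Maybe using (Maybe; just; nothing)
open import Data.List using (List; []; _∷_; map)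
open import Data.List.Membership.Propositional using (_∈_; _∉_)
open import Data.Product using (Σ; ∃; _×_; _,_)
open import Data.Sum using (_⊎_)
open import Relation.Nullary using (¬_; yes; no)
open import Relation.Binary.Definitions using (DecidableEquality)
open import Relation.Binary.PropositionalEquality using (_≡_; _≢_)

module Theory (A : Set) (_≟_ : DecidableEquality A) (τ : A) where

  record SyncSet : Set₁ where
    field
      mem : A → Set
      τ∉ : ¬ mem τ
  open SyncSet public

  data PT : Set₁ where
    ev   : A → PT
    pfx  : A → PT → PT
    cl   : PT → PT
    cr   : PT → PT
    pl   : SyncSet → PT → PT
    pr   : SyncSet → PT → PT
    syn  : SyncSet → PT → PT → PT

  act : PT → Maybe A
  act (ev a) = just a
  act (pfx a θ) = act θ
  act (cl θ) = act θ
  act (cr θ) = act θ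
  act (pl L θ) = act θ
  act (pr L θ) = act θ
  act (syn L θ₁ θ₂) with act θ₁ | act θ₂
  ... | just a | just b with a ≟ b
  ...   | yes _ = just a
  ...   | no _ = nothing
  act (syn L θ₁ θ₂) | _ | _ = nothing

  NotInL : SyncSet → PT → Set
  NotInL L θ = Σ A λ a → act θ ≡ just a × ¬ mem L a

  SyncInL : SyncSet → PT → PT → Set
  SyncInL L θ₁ θ₂ = Σ A λ a → act θ₁ ≡ just a × act θ₂ ≡ just a × mem L a

  data Deco : Set₁ where
    ε    : Deco
    deco : SyncSet → PT → PT → Deco

  data Proc : Set₁ where
    𝟘    : Proc
    pre  : A → Proc → Proc
    done : A → Deco → Proc → Proc
    _⊕_  : Proc → Proc → Proc
    par  : SyncSet → Proc → Proc → Proc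

  data Initial : Proc → Set₁ where
    i𝟘   : Initial 𝟘
    ipre : ∀ {a P} → Initial P → Initial (pre a P)
    i⊕   : ∀ {P Q} → Initial P → Initial Q → Initial (P ⊕ Q)
    ipar : ∀ {L P Q} → Initial P → Initial Q → Initial (par L P Q)

  toinitial : Proc → Proc
  toinitial 𝟘 = 𝟘
  toinitial (pre a P) = pre a (toinitial P)
  toinitial (done a ξ P) = pre a (toinitial P)
  toinitial (P ⊕ Q) = toinitial P ⊕ toinitial Q
  toinitial (par L P Q) = par L (toinitial P) (toinitial Q)

  -- enr'(P, θ, θ̄); the paper's equations, all other (never used) cases
  -- leave the process unchanged
  enr' : Proc → PT → PT → Proc
  enr' 𝟘 θ θ̄ = 𝟘
  enr' (done a ξ P) (ev b) (syn L θ₁ θ₂) = done a (deco L θ₁ θ₂) P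
  enr' (done a ξ P) (pfx b θ) θ̄ = done a ξ (enr' P θ θ̄)
  enr' (P ⊕ Q) (cl θ) θ̄ = enr' P θ θ̄ ⊕ Q
  enr' (P ⊕ Q) (cr θ) θ̄ = P ⊕ enr' Q θ θ̄
  enr' (par L P Q) (pl L' θ) θ̄ = par L (enr' P θ θ̄) Q
  enr' (par L P Q) (pr L' θ) θ̄ = par L P (enr' Q θ θ̄)
  enr' (par L P Q) (syn L' θ₁ θ₂) θ̄ = par L (enr' P θ₁ θ̄) (enr' Q θ₂ θ̄)
  enr' P θ θ̄ = P

  enr : Proc → PT → Proc
  enr P θ̄ = enr' P θ̄ θ̄

  data _─[_]→_ : Proc → PT → Proc → Set₁ where
    Actf : ∀ {a P} → Initial P → pre a P ─[ ev a ]→ done a ε P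
    Actp : ∀ {a ξ P P' θ} → P ─[ θ ]→ P' → done a ξ P ─[ pfx a θ ]→ done a ξ P'
    Chol : ∀ {P₁ P₁' P₂ θ} → P₁ ─[ θ ]→ P₁' → Initial P₂ →
           (P₁ ⊕ P₂) ─[ cl θ ]→ (P₁' ⊕ P₂)
    Chor : ∀ {P₁ P₂ P₂' θ} → P₂ ─[ θ ]→ P₂' → Initial P₁ →
           (P₁ ⊕ P₂) ─[ cr θ ]→ (P₁ ⊕ P₂')
    Parl : ∀ {L P₁ P₁' P₂ θ} → P₁ ─[ θ ]→ P₁' → NotInL L θ →
           par L P₁ P₂ ─[ pl L θ ]→ par L P₁' P₂
    Parr : ∀ {L P₁ P₂ P₂' θ} → P₂ ─[ θ ]→ P₂' → NotInL L θ →
           par L P₁ P₂ ─[ pr L θ ]→ par L P₁ P₂'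
    Syn  : ∀ {L P₁ P₁' P₂ P₂' θ₁ θ₂} → P₁ ─[ θ₁ ]→ P₁' → P₂ ─[ θ₂ ]→ P₂' →
           SyncInL L θ₁ θ₂ →
           par L P₁ P₂ ─[ syn L θ₁ θ₂ ]→ enr (par L P₁' P₂') (syn L θ₁ θ₂)

  data Trace : Proc → List PT → Proc → Set₁ where
    nil  : ∀ {P} → Trace P [] P
    cons : ∀ {P P' P'' θ θs} → P ─[ θ ]→ P' → Trace P' θs P'' →
           Trace P (θ ∷ θs) P''

  Reachable : Proc → Set₁
  Reachable P = Σ Proc λ Q → Initial Q × Σ (List PT) λ θs → Trace Q θs P

  -- X is (a list representation of) X_P
  IsXP : Proc → List PT → Set₁
  IsXP P X = (Initial P × X ≡ [])
           ⊎ ((¬ Initial P) × Trace (toinitial P) X P)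

  -- Configuration structures with proof-term events, labelling ℓ = act.
  -- Finite sets of events are lists, compared extensionally (membership).

  _⊆_ : List PT → List PT → Set₁
  X ⊆ Y = ∀ {e} → e ∈ X → e ∈ Y

  _≋_ : List PT → List PT → Set₁
  X ≋ Y = X ⊆ Y × Y ⊆ X

  record CS : Set₂ where
    field
      Ev   : PT → Set₁
      Conf : List PT → Set₁
  open CS public

  CTransEv : CS → List PT → PT → A → List PT → Set₁
  CTransEv C X e a X' =
    Conf C X × Conf C X' × X ⊆ X' × e ∈ X' × e ∉ X ×
    (∀ {e'} → e' ∈ X' → e' ∉ X → e' ≡ e) × act e ≡ just a

  N : CS
  Ev N e = Lift (suc 0ℓ) ⊥
  Conf N X = X ≋ []

  prefixCS : A → CS → CS
  Ev (prefixCS a C) e = (e ≡ ev a) ⊎ (Σ PT λ θ → Ev C θ × e ≡ pfx a θ)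
  Conf (prefixCS a C) X =
    (X ≋ []) ⊎ (Σ (List PT) λ Y → Conf C Y × X ≋ (ev a ∷ map (pfx a) Y))

  sumCS : CS → CS → CS
  Ev (sumCS C₁ C₂) e = (Σ PT λ θ → Ev C₁ θ × e ≡ cl θ)
                     ⊎ (Σ PT λ θ → Ev C₂ θ × e ≡ cr θ)
  Conf (sumCS C₁ C₂) X = (Σ (List PT) λ Y → Conf C₁ Y × X ≋ map cl Y)
                       ⊎ (Σ (List PT) λ Y → Conf C₂ Y × X ≋ map cr Y)

  proj₁ˢ : List PT → List PT
  proj₁ˢ [] = []
  proj₁ˢ (pl _ θ ∷ X) = θ ∷ proj₁ˢ X
  proj₁ˢ (syn _ θ₁ θ₂ ∷ X) = θ₁ ∷ proj₁ˢ X
  proj₁ˢ (_ ∷ X) = proj₁ˢ X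

  proj₂ˢ : List PT → List PT
  proj₂ˢ [] = []
  proj₂ˢ (pr _ θ ∷ X) = θ ∷ proj₂ˢ X
  proj₂ˢ (syn _ θ₁ θ₂ ∷ X) = θ₂ ∷ proj₂ˢ X
  proj₂ˢ (_ ∷ X) = proj₂ˢ X

  parCS : SyncSet → CS → CS → CS
  Ev (parCS L C₁ C₂) e =
      (Σ PT λ θ → e ≡ pl L θ × Ev C₁ θ × NotInL L θ)
    ⊎ (Σ PT λ θ → e ≡ pr L θ × Ev C₂ θ × NotInL L θ)
    ⊎ (Σ PT λ θ₁ → Σ PT λ θ₂ → e ≡ syn L θ₁ θ₂ × Ev C₁ θ₁ × Ev C₂ θ₂ ×
                                SyncInL L θ₁ θ₂)
  Conf (parCS L C₁ C₂) X =
      (∀ {e} → e ∈ X → Ev (parCS L C₁ C₂) e)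
    × Conf C₁ (proj₁ˢ X) × Conf C₂ (proj₂ˢ X)
    × (∀ {e e'} → e ∈ X → e' ∈ X →
         ((proj₁ˢ (e ∷ []) ≡ proj₁ˢ (e' ∷ []) × proj₁ˢ (e ∷ []) ≢ [])
          ⊎ (proj₂ˢ (e ∷ []) ≡ proj₂ˢ (e' ∷ []) × proj₂ˢ (e ∷ []) ≢ []))
         → e ≡ e')
    × (∀ {e e'} → e ∈ X → e' ∈ X → e ≢ e' →
         Σ (List PT) λ Y → Y ⊆ X × Conf C₁ (proj₁ˢ Y) × Conf C₂ (proj₂ˢ Y)
           × ((e ∈ Y → e' ∉ Y) × (e' ∉ Y → e ∈ Y)))

  -- scs; the paper defines it on initial processes only, the clause for
  -- executed prefixes is irrelevant (scs is only applied to toinitial P)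
  scs : Proc → CS
  scs 𝟘 = N
  scs (pre a Q) = prefixCS a (scs Q)
  scs (done a ξ Q) = prefixCS a (scs Q)
  scs (Q₁ ⊕ Q₂) = sumCS (scs Q₁) (scs Q₂)
  scs (par L Q₁ Q₂) = parCS L (scs Q₁) (scs Q₂)

  C[_] : Proc → CS
  C[ P ] = scs (toinitial P)

-- A proved transition by θ decorates exactly the prefixes it executes (the leaves of θ), which
-- were undecorated before, with the stamp of θ: its outermost synchronisation, or ε. Hence after
-- any trace from toinitial P the decorations of P are those painted by the events of the trace,
-- and conversely these decorations determine P and the set of events: an event is recovered
-- from the stamp at its shortest leaf together with its depth, the distance from the root to
-- its outermost synchronisation. So X_P does not depend on the trace, and P ─[ θ ]→ P' forces
-- X_P' = X_P ∪ {θ}. On the side of C_P, forgetting decorations turns traces into runs whose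
-- event sets are configurations, and a configuration extending the events of a run by one
-- event θ is enabled by a step θ at the end of the run, which lifts to a proved transition.

{-# OPTIONS --safe #-}
module Submission where

open import Defs
open import Data.Bool using (true; false; if_then_else_)
open import Data.Empty using (⊥-elim)
open import Data.List using (List; []; _∷_; _++_; _∷ʳ_; _ʳ++_; map; reverse; length)
open import Data.List.Membership.Propositional using (_∈_; _∉_; find; lose)
open import Data.List.Membership.Propositional.Properties using (∈-map⁺; ∈-map⁻; ∈-++⁺ˡ; ∈-++⁺ʳ; ∈-++⁻)
open import Data.List.Relation.Binary.Permutation.Propositional using (_↭_; ↭-sym)
open import Data.List.Relation.Binary.Permutation.Propositional.Properties using (∈-resp-↭; ∷↭∷ʳ; ↭-reverse)
open import Data.List.Relation.Unary.Any using (here; there; any?)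
open import Data.Maybe using (Maybe; just; nothing)
open import Data.Maybe.Properties using (just-injective)
open import Data.Nat using (ℕ; suc; _+_; _≤_; _<_; _⊓_; z≤n; s≤s)
open import Data.Nat.Properties
  using (≤-refl; ≤-trans; <-≤-trans; m≤n⇒m<n∨m≡n; m⊓n≤m; m⊓n≤n; ⊓-sel; +-cancelʳ-≤; suc-injective; module ≤-Reasoning)
open import Data.Product using (Σ; _×_; _,_; proj₁; proj₂)
open import Data.Sum using (_⊎_; inj₁; inj₂; [_,_])
open import Function using (_∘_; case_of_)
open import Function.Bundles using (_⇔_; mk⇔; Equivalence)
open import Function.Properties.Equivalence using () renaming (trans to ⇔-trans)
open import Relation.Binary.Definitions using (DecidableEquality)
open import Relation.Binary.PropositionalEquality
  using (_≡_; _≢_; _≗_; refl; sym; trans; cong; cong₂; subst; subst₂; module ≡-Reasoning)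
open import Relation.Nullary using (¬_; Dec; yes; no; does; contradiction)
open import Relation.Nullary.Decidable using (map′)

module Correspondence (A : Set) (_≟_ : DecidableEquality A) (τ : A) where
  open Theory A _≟_ τ

  toinitial-initial : ∀ {P} → Initial P → toinitial P ≡ P
  toinitial-initial i𝟘 = refl
  toinitial-initial (ipre i) = cong (pre _) (toinitial-initial i)
  toinitial-initial (i⊕ i j) = cong₂ _⊕_ (toinitial-initial i) (toinitial-initial j)
  toinitial-initial (ipar i j) = cong₂ (par _) (toinitial-initial i) (toinitial-initial j)

  initial-toinitial : ∀ P → Initial (toinitial P)
  initial-toinitial 𝟘 = i𝟘
  initial-toinitial (pre a P) = ipre (initial-toinitial P)
  initial-toinitial (done a ξ P) = ipre (initial-toinitial P)
  initial-toinitial (P ⊕ Q) = i⊕ (initial-toinitial P) (initial-toinitial Q)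
  initial-toinitial (par L P Q) = ipar (initial-toinitial P) (initial-toinitial Q)

  skeleton : Proc → Proc
  skeleton 𝟘 = 𝟘
  skeleton (pre a P) = pre a (skeleton P)
  skeleton (done a ξ P) = done a ε (skeleton P)
  skeleton (P ⊕ Q) = skeleton P ⊕ skeleton Q
  skeleton (par L P Q) = par L (skeleton P) (skeleton Q)

  skeleton-initial : ∀ {P} → Initial P → skeleton P ≡ P
  skeleton-initial i𝟘 = refl
  skeleton-initial (ipre i) = cong (pre _) (skeleton-initial i)
  skeleton-initial (i⊕ i j) = cong₂ _⊕_ (skeleton-initial i) (skeleton-initial j)
  skeleton-initial (ipar i j) = cong₂ (par _) (skeleton-initial i) (skeleton-initial j)

  initial-skeleton : ∀ {P} → Initial P → Initial (skeleton P)
  initial-skeleton i = subst Initial (sym (skeleton-initial i)) i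

  initial-skeleton⁻ : ∀ P → Initial (skeleton P) → Initial P
  initial-skeleton⁻ 𝟘 i𝟘 = i𝟘
  initial-skeleton⁻ (pre a P) (ipre i) = ipre (initial-skeleton⁻ P i)
  initial-skeleton⁻ (P ⊕ Q) (i⊕ i j) = i⊕ (initial-skeleton⁻ P i) (initial-skeleton⁻ Q j)
  initial-skeleton⁻ (par L P Q) (ipar i j) = ipar (initial-skeleton⁻ P i) (initial-skeleton⁻ Q j)

  toinitial-skeleton : ∀ P → toinitial (skeleton P) ≡ toinitial P
  toinitial-skeleton 𝟘 = refl
  toinitial-skeleton (pre a P) = cong (pre a) (toinitial-skeleton P)
  toinitial-skeleton (done a ξ P) = cong (pre a) (toinitial-skeleton P)
  toinitial-skeleton (P ⊕ Q) = cong₂ _⊕_ (toinitial-skeleton P) (toinitial-skeleton Q)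
  toinitial-skeleton (par L P Q) = cong₂ (par L) (toinitial-skeleton P) (toinitial-skeleton Q)

  -- Decoration-free transitions

  -- Components of a synchronised process are not reachable by proved transitions (enr rewrites
  -- their decorations), so configurations are analysed through these steps on skeletons.
  infix 4 _─[_]→ˢ_
  data _─[_]→ˢ_ : Proc → PT → Proc → Set₁ where
    Actf : ∀ {a P} → Initial P → pre a P ─[ ev a ]→ˢ done a ε P
    Actp : ∀ {a ξ P P' θ} → P ─[ θ ]→ˢ P' → done a ξ P ─[ pfx a θ ]→ˢ done a ξ P'
    Chol : ∀ {P₁ P₁' P₂ θ} → P₁ ─[ θ ]→ˢ P₁' → Initial P₂ → P₁ ⊕ P₂ ─[ cl θ ]→ˢ P₁' ⊕ P₂
    Chor : ∀ {P₁ P₂ P₂' θ} → P₂ ─[ θ ]→ˢ P₂' → Initial P₁ → P₁ ⊕ P₂ ─[ cr θ ]→ˢ P₁ ⊕ P₂'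
    Parl : ∀ {L P₁ P₁' P₂ θ} → P₁ ─[ θ ]→ˢ P₁' → NotInL L θ →
           par L P₁ P₂ ─[ pl L θ ]→ˢ par L P₁' P₂
    Parr : ∀ {L P₁ P₂ P₂' θ} → P₂ ─[ θ ]→ˢ P₂' → NotInL L θ →
           par L P₁ P₂ ─[ pr L θ ]→ˢ par L P₁ P₂'
    Syn  : ∀ {L P₁ P₁' P₂ P₂' θ₁ θ₂} → P₁ ─[ θ₁ ]→ˢ P₁' → P₂ ─[ θ₂ ]→ˢ P₂' →
           SyncInL L θ₁ θ₂ → par L P₁ P₂ ─[ syn L θ₁ θ₂ ]→ˢ par L P₁' P₂'

  stepˢ-toinitial : ∀ {R θ R'} → R ─[ θ ]→ˢ R' → toinitial R ≡ toinitial R'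
  stepˢ-toinitial (Actf i) = refl
  stepˢ-toinitial (Actp s) = cong (pre _) (stepˢ-toinitial s)
  stepˢ-toinitial (Chol s i) = cong (_⊕ _) (stepˢ-toinitial s)
  stepˢ-toinitial (Chor s i) = cong (_ ⊕_) (stepˢ-toinitial s)
  stepˢ-toinitial (Parl s n) = cong (λ R → par _ R _) (stepˢ-toinitial s)
  stepˢ-toinitial (Parr s n) = cong (par _ _) (stepˢ-toinitial s)
  stepˢ-toinitial (Syn s t c) = cong₂ (par _) (stepˢ-toinitial s) (stepˢ-toinitial t)

  stepˢ-non-initial : ∀ {R θ R'} → R ─[ θ ]→ˢ R' → ¬ Initial R'
  stepˢ-non-initial (Chol s _) (i⊕ i _) = stepˢ-non-initial s i
  stepˢ-non-initial (Chor s _) (i⊕ _ i) = stepˢ-non-initial s i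
  stepˢ-non-initial (Parl s _) (ipar i _) = stepˢ-non-initial s i
  stepˢ-non-initial (Parr s _) (ipar _ i) = stepˢ-non-initial s i
  stepˢ-non-initial (Syn s _ _) (ipar i _) = stepˢ-non-initial s i

  data Valid : Proc → PT → Set₁ where
    ev   : ∀ {a Q} → Valid (pre a Q) (ev a)
    pfx  : ∀ {a Q θ} → Valid Q θ → Valid (pre a Q) (pfx a θ)
    cl   : ∀ {Q₁ Q₂ θ} → Valid Q₁ θ → Valid (Q₁ ⊕ Q₂) (cl θ)
    cr   : ∀ {Q₁ Q₂ θ} → Valid Q₂ θ → Valid (Q₁ ⊕ Q₂) (cr θ)
    pl   : ∀ {L Q₁ Q₂ θ} → Valid Q₁ θ → Valid (par L Q₁ Q₂) (pl L θ)
    pr   : ∀ {L Q₁ Q₂ θ} → Valid Q₂ θ → Valid (par L Q₁ Q₂) (pr L θ)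
    syn  : ∀ {L Q₁ Q₂ θ₁ θ₂} → Valid Q₁ θ₁ → Valid Q₂ θ₂ → Valid (par L Q₁ Q₂) (syn L θ₁ θ₂)

  stepˢ-valid : ∀ {R θ R'} → R ─[ θ ]→ˢ R' → Valid (toinitial R) θ
  stepˢ-valid (Actf i) = ev
  stepˢ-valid (Actp s) = pfx (stepˢ-valid s)
  stepˢ-valid (Chol s i) = cl (stepˢ-valid s)
  stepˢ-valid (Chor s i) = cr (stepˢ-valid s)
  stepˢ-valid (Parl s n) = pl (stepˢ-valid s)
  stepˢ-valid (Parr s n) = pr (stepˢ-valid s)
  stepˢ-valid (Syn s t c) = syn (stepˢ-valid s) (stepˢ-valid t)

  stepˢ-event : ∀ {R θ R'} → R ─[ θ ]→ˢ R' → Ev (scs (toinitial R)) θ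
  stepˢ-event (Actf i) = inj₁ refl
  stepˢ-event (Actp s) = inj₂ (_ , stepˢ-event s , refl)
  stepˢ-event (Chol s i) = inj₁ (_ , stepˢ-event s , refl)
  stepˢ-event (Chor s i) = inj₂ (_ , stepˢ-event s , refl)
  stepˢ-event (Parl s n) = inj₁ (_ , refl , stepˢ-event s , n)
  stepˢ-event (Parr s n) = inj₂ (inj₁ (_ , refl , stepˢ-event s , n))
  stepˢ-event (Syn s t c) = inj₂ (inj₂ (_ , _ , refl , stepˢ-event s , stepˢ-event t , c))

  act-syn : ∀ {L θ₁ θ₂ a} → act θ₁ ≡ just a → act θ₂ ≡ just a → act (syn L θ₁ θ₂) ≡ just a
  act-syn {a = a} e₁ e₂ rewrite e₁ | e₂ with a ≟ a
  ... | yes _ = refl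
  ... | no a≢a = contradiction refl a≢a

  stepˢ-act : ∀ {R θ R'} → R ─[ θ ]→ˢ R' → Σ A λ a → act θ ≡ just a
  stepˢ-act (Actf i) = _ , refl
  stepˢ-act (Actp s) = stepˢ-act s
  stepˢ-act (Chol s i) = stepˢ-act s
  stepˢ-act (Chor s i) = stepˢ-act s
  stepˢ-act (Parl s (a , act≡ , _)) = a , act≡
  stepˢ-act (Parr s (a , act≡ , _)) = a , act≡
  stepˢ-act (Syn {L} {θ₁ = θ₁} {θ₂} s t (a , act₁≡ , act₂≡ , _)) = a , act-syn {L} {θ₁} {θ₂} act₁≡ act₂≡

  data Fits : Proc → PT → Set₁ where
    ev   : ∀ {a ξ P b} → Fits (done a ξ P) (ev b)
    pfx  : ∀ {a ξ P b θ} → Fits P θ → Fits (done a ξ P) (pfx b θ)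
    cl   : ∀ {P Q θ} → Fits P θ → Fits (P ⊕ Q) (cl θ)
    cr   : ∀ {P Q θ} → Fits Q θ → Fits (P ⊕ Q) (cr θ)
    pl   : ∀ {L P Q L' θ} → Fits P θ → Fits (par L P Q) (pl L' θ)
    pr   : ∀ {L P Q L' θ} → Fits Q θ → Fits (par L P Q) (pr L' θ)
    syn  : ∀ {L P Q L' θ₁ θ₂} → Fits P θ₁ → Fits Q θ₂ → Fits (par L P Q) (syn L' θ₁ θ₂)

  module _ {L : SyncSet} {θ₁ θ₂ : PT} where

    enr'-fits : ∀ {P θ} → Fits P θ → Fits (enr' P θ (syn L θ₁ θ₂)) θ
    enr'-fits ev = ev
    enr'-fits (pfx f) = pfx (enr'-fits f)
    enr'-fits (cl f) = cl (enr'-fits f)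
    enr'-fits (cr f) = cr (enr'-fits f)
    enr'-fits (pl f) = pl (enr'-fits f)
    enr'-fits (pr f) = pr (enr'-fits f)
    enr'-fits (syn f g) = syn (enr'-fits f) (enr'-fits g)

    skeleton-enr' : ∀ {P θ} → Fits P θ → skeleton (enr' P θ (syn L θ₁ θ₂)) ≡ skeleton P
    skeleton-enr' ev = refl
    skeleton-enr' (pfx f) = cong (done _ ε) (skeleton-enr' f)
    skeleton-enr' (cl f) = cong (_⊕ _) (skeleton-enr' f)
    skeleton-enr' (cr f) = cong (_ ⊕_) (skeleton-enr' f)
    skeleton-enr' (pl f) = cong (λ R → par _ R _) (skeleton-enr' f)
    skeleton-enr' (pr f) = cong (par _ _) (skeleton-enr' f)
    skeleton-enr' (syn f g) = cong₂ (par _) (skeleton-enr' f) (skeleton-enr' g)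

  step-fits : ∀ {P θ P'} → P ─[ θ ]→ P' → Fits P' θ
  step-fits (Actf i) = ev
  step-fits (Actp s) = pfx (step-fits s)
  step-fits (Chol s i) = cl (step-fits s)
  step-fits (Chor s i) = cr (step-fits s)
  step-fits (Parl s n) = pl (step-fits s)
  step-fits (Parr s n) = pr (step-fits s)
  step-fits (Syn s t c) = syn (enr'-fits (step-fits s)) (enr'-fits (step-fits t))

  step-skeleton : ∀ {P θ P'} → P ─[ θ ]→ P' → skeleton P ─[ θ ]→ˢ skeleton P'
  step-skeleton (Actf i) = Actf (initial-skeleton i)
  step-skeleton (Actp s) = Actp (step-skeleton s)
  step-skeleton (Chol s i) = Chol (step-skeleton s) (initial-skeleton i)
  step-skeleton (Chor s i) = Chor (step-skeleton s) (initial-skeleton i)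
  step-skeleton (Parl s n) = Parl (step-skeleton s) n
  step-skeleton (Parr s n) = Parr (step-skeleton s) n
  step-skeleton (Syn {L} {θ₁ = θ₁} {θ₂} s t c) =
    subst₂ (λ R₁ R₂ → _ ─[ syn L θ₁ θ₂ ]→ˢ par L R₁ R₂)
      (sym (skeleton-enr' (step-fits s))) (sym (skeleton-enr' (step-fits t)))
      (Syn (step-skeleton s) (step-skeleton t) c)

  step-toinitial : ∀ {P θ P'} → P ─[ θ ]→ P' → toinitial P ≡ toinitial P'
  step-toinitial {P} {P' = P'} s = begin
    toinitial P                ≡⟨ toinitial-skeleton P ⟨
    toinitial (skeleton P)     ≡⟨ stepˢ-toinitial (step-skeleton s) ⟩
    toinitial (skeleton P')    ≡⟨ toinitial-skeleton P' ⟩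
    toinitial P'               ∎
    where open ≡-Reasoning

  step-valid : ∀ {P θ P'} → P ─[ θ ]→ P' → Valid (toinitial P) θ
  step-valid {P} s = subst (λ Q → Valid Q _) (toinitial-skeleton P) (stepˢ-valid (step-skeleton s))

  lift : ∀ P {θ R} → skeleton P ─[ θ ]→ˢ R → Σ Proc λ P' → P ─[ θ ]→ P' × skeleton P' ≡ R
  lift (pre a P) (Actf i) = done a ε P , Actf (initial-skeleton⁻ P i) , refl
  lift (done a ξ P) (Actp s) with lift P s
  ... | P' , s' , refl = done a ξ P' , Actp s' , refl
  lift (P ⊕ Q) (Chol s i) with lift P s
  ... | P' , s' , refl = P' ⊕ Q , Chol s' (initial-skeleton⁻ Q i) , refl
  lift (P ⊕ Q) (Chor s i) with lift Q s
  ... | Q' , s' , refl = P ⊕ Q' , Chor s' (initial-skeleton⁻ P i) , refl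
  lift (par L P Q) (Parl s n) with lift P s
  ... | P' , s' , refl = par L P' Q , Parl s' n , refl
  lift (par L P Q) (Parr s n) with lift Q s
  ... | Q' , s' , refl = par L P Q' , Parr s' n , refl
  lift (par L P Q) (Syn s t c) with lift P s | lift Q t
  ... | P' , s' , refl | Q' , t' , refl =
    _ , Syn s' t' c , cong₂ (par L) (skeleton-enr' (step-fits s')) (skeleton-enr' (step-fits t'))

  -- Positions and decorations

  data Dir : Set where
    inside left right : Dir

  Pos : Set
  Pos = List Dir

  decoAt : Proc → Pos → Maybe Deco
  decoAt (done a ξ P) [] = just ξ
  decoAt (done a ξ P) (inside ∷ p) = decoAt P p
  decoAt (pre a P) (inside ∷ p) = decoAt P p
  decoAt (P ⊕ Q) (left ∷ p) = decoAt P p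
  decoAt (P ⊕ Q) (right ∷ p) = decoAt Q p
  decoAt (par L P Q) (left ∷ p) = decoAt P p
  decoAt (par L P Q) (right ∷ p) = decoAt Q p
  decoAt _ _ = nothing

  decoAt-initial : ∀ {Q} → Initial Q → ∀ p → decoAt Q p ≡ nothing
  decoAt-initial i𝟘 p = refl
  decoAt-initial (ipre i) [] = refl
  decoAt-initial (ipre i) (inside ∷ p) = decoAt-initial i p
  decoAt-initial (ipre i) (left ∷ p) = refl
  decoAt-initial (ipre i) (right ∷ p) = refl
  decoAt-initial (i⊕ i j) [] = refl
  decoAt-initial (i⊕ i j) (inside ∷ p) = refl
  decoAt-initial (i⊕ i j) (left ∷ p) = decoAt-initial i p
  decoAt-initial (i⊕ i j) (right ∷ p) = decoAt-initial j p
  decoAt-initial (ipar i j) [] = refl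
  decoAt-initial (ipar i j) (inside ∷ p) = refl
  decoAt-initial (ipar i j) (left ∷ p) = decoAt-initial i p
  decoAt-initial (ipar i j) (right ∷ p) = decoAt-initial j p

  data Leaf : PT → Pos → Set₁ where
    ev  : ∀ {a} → Leaf (ev a) []
    pfx : ∀ {a θ p} → Leaf θ p → Leaf (pfx a θ) (inside ∷ p)
    cl  : ∀ {θ p} → Leaf θ p → Leaf (cl θ) (left ∷ p)
    cr  : ∀ {θ p} → Leaf θ p → Leaf (cr θ) (right ∷ p)
    pl  : ∀ {L θ p} → Leaf θ p → Leaf (pl L θ) (left ∷ p)
    pr  : ∀ {L θ p} → Leaf θ p → Leaf (pr L θ) (right ∷ p)
    synˡ : ∀ {L θ₁ θ₂ p} → Leaf θ₁ p → Leaf (syn L θ₁ θ₂) (left ∷ p)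
    synʳ : ∀ {L θ₁ θ₂ p} → Leaf θ₂ p → Leaf (syn L θ₁ θ₂) (right ∷ p)

  leaf? : ∀ θ p → Dec (Leaf θ p)
  leaf? (ev a) [] = yes ev
  leaf? (ev a) (_ ∷ _) = no λ ()
  leaf? (pfx a θ) [] = no λ ()
  leaf? (pfx a θ) (inside ∷ p) = map′ pfx (λ { (pfx l) → l }) (leaf? θ p)
  leaf? (pfx a θ) (left ∷ p) = no λ ()
  leaf? (pfx a θ) (right ∷ p) = no λ ()
  leaf? (cl θ) [] = no λ ()
  leaf? (cl θ) (inside ∷ p) = no λ ()
  leaf? (cl θ) (left ∷ p) = map′ cl (λ { (cl l) → l }) (leaf? θ p)
  leaf? (cl θ) (right ∷ p) = no λ ()
  leaf? (cr θ) [] = no λ ()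
  leaf? (cr θ) (inside ∷ p) = no λ ()
  leaf? (cr θ) (left ∷ p) = no λ ()
  leaf? (cr θ) (right ∷ p) = map′ cr (λ { (cr l) → l }) (leaf? θ p)
  leaf? (pl L θ) [] = no λ ()
  leaf? (pl L θ) (inside ∷ p) = no λ ()
  leaf? (pl L θ) (left ∷ p) = map′ pl (λ { (pl l) → l }) (leaf? θ p)
  leaf? (pl L θ) (right ∷ p) = no λ ()
  leaf? (pr L θ) [] = no λ ()
  leaf? (pr L θ) (inside ∷ p) = no λ ()
  leaf? (pr L θ) (left ∷ p) = no λ ()
  leaf? (pr L θ) (right ∷ p) = map′ pr (λ { (pr l) → l }) (leaf? θ p)
  leaf? (syn L θ₁ θ₂) [] = no λ ()
  leaf? (syn L θ₁ θ₂) (inside ∷ p) = no λ ()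
  leaf? (syn L θ₁ θ₂) (left ∷ p) = map′ synˡ (λ { (synˡ l) → l }) (leaf? θ₁ p)
  leaf? (syn L θ₁ θ₂) (right ∷ p) = map′ synʳ (λ { (synʳ l) → l }) (leaf? θ₂ p)

  -- Enrichment at the outermost synchronisation overwrites all inner ones.
  stamp : PT → Deco
  stamp (ev a) = ε
  stamp (pfx a θ) = stamp θ
  stamp (cl θ) = stamp θ
  stamp (cr θ) = stamp θ
  stamp (pl L θ) = stamp θ
  stamp (pr L θ) = stamp θ
  stamp (syn L θ₁ θ₂) = deco L θ₁ θ₂

  paint : PT → Deco → (Pos → Maybe Deco) → Pos → Maybe Deco
  paint θ ξ d p = if does (leaf? θ p) then just ξ else d p

  paint-cong : ∀ θ ξ {d d'} → d ≗ d' → paint θ ξ d ≗ paint θ ξ d'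
  paint-cong θ ξ d≗d' p with does (leaf? θ p)
  ... | true = refl
  ... | false = d≗d' p

  paint-paint : ∀ θ ξ ξ' d → paint θ ξ (paint θ ξ' d) ≗ paint θ ξ d
  paint-paint θ ξ ξ' d p with does (leaf? θ p)
  ... | true = refl
  ... | false = refl

  module _ {L : SyncSet} {θ₁ θ₂ : PT} where

    decoAt-enr' : ∀ {P θ} → Fits P θ → decoAt (enr' P θ (syn L θ₁ θ₂)) ≗ paint θ (deco L θ₁ θ₂) (decoAt P)
    decoAt-enr' ev [] = refl
    decoAt-enr' ev (inside ∷ p) = refl
    decoAt-enr' ev (left ∷ p) = refl
    decoAt-enr' ev (right ∷ p) = refl
    decoAt-enr' (pfx f) [] = refl
    decoAt-enr' (pfx f) (inside ∷ p) = decoAt-enr' f p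
    decoAt-enr' (pfx f) (left ∷ p) = refl
    decoAt-enr' (pfx f) (right ∷ p) = refl
    decoAt-enr' (cl f) [] = refl
    decoAt-enr' (cl f) (inside ∷ p) = refl
    decoAt-enr' (cl f) (left ∷ p) = decoAt-enr' f p
    decoAt-enr' (cl f) (right ∷ p) = refl
    decoAt-enr' (cr f) [] = refl
    decoAt-enr' (cr f) (inside ∷ p) = refl
    decoAt-enr' (cr f) (left ∷ p) = refl
    decoAt-enr' (cr f) (right ∷ p) = decoAt-enr' f p
    decoAt-enr' (pl f) [] = refl
    decoAt-enr' (pl f) (inside ∷ p) = refl
    decoAt-enr' (pl f) (left ∷ p) = decoAt-enr' f p
    decoAt-enr' (pl f) (right ∷ p) = refl
    decoAt-enr' (pr f) [] = refl
    decoAt-enr' (pr f) (inside ∷ p) = refl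
    decoAt-enr' (pr f) (left ∷ p) = refl
    decoAt-enr' (pr f) (right ∷ p) = decoAt-enr' f p
    decoAt-enr' (syn f g) [] = refl
    decoAt-enr' (syn f g) (inside ∷ p) = refl
    decoAt-enr' (syn f g) (left ∷ p) = decoAt-enr' f p
    decoAt-enr' (syn f g) (right ∷ p) = decoAt-enr' g p

    decoAt-enr'-repaint : ∀ P {P' θ} → Fits P' θ → decoAt P' ≗ paint θ (stamp θ) (decoAt P) →
                          decoAt (enr' P' θ (syn L θ₁ θ₂)) ≗ paint θ (deco L θ₁ θ₂) (decoAt P)
    decoAt-enr'-repaint P {P'} {θ} f d≗ p = begin
      decoAt (enr' P' θ (syn L θ₁ θ₂)) p                       ≡⟨ decoAt-enr' f p ⟩
      paint θ (deco L θ₁ θ₂) (decoAt P') p                      ≡⟨ paint-cong θ _ d≗ p ⟩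
      paint θ (deco L θ₁ θ₂) (paint θ (stamp θ) (decoAt P)) p   ≡⟨ paint-paint θ _ _ (decoAt P) p ⟩
      paint θ (deco L θ₁ θ₂) (decoAt P) p                       ∎
      where open ≡-Reasoning

  decoAt-step : ∀ {P θ P'} → P ─[ θ ]→ P' → decoAt P' ≗ paint θ (stamp θ) (decoAt P)
  decoAt-step (Actf i) [] = refl
  decoAt-step (Actf i) (inside ∷ p) = refl
  decoAt-step (Actf i) (left ∷ p) = refl
  decoAt-step (Actf i) (right ∷ p) = refl
  decoAt-step (Actp s) [] = refl
  decoAt-step (Actp s) (inside ∷ p) = decoAt-step s p
  decoAt-step (Actp s) (left ∷ p) = refl
  decoAt-step (Actp s) (right ∷ p) = refl
  decoAt-step (Chol s i) [] = refl
  decoAt-step (Chol s i) (inside ∷ p) = refl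
  decoAt-step (Chol s i) (left ∷ p) = decoAt-step s p
  decoAt-step (Chol s i) (right ∷ p) = refl
  decoAt-step (Chor s i) [] = refl
  decoAt-step (Chor s i) (inside ∷ p) = refl
  decoAt-step (Chor s i) (left ∷ p) = refl
  decoAt-step (Chor s i) (right ∷ p) = decoAt-step s p
  decoAt-step (Parl s n) [] = refl
  decoAt-step (Parl s n) (inside ∷ p) = refl
  decoAt-step (Parl s n) (left ∷ p) = decoAt-step s p
  decoAt-step (Parl s n) (right ∷ p) = refl
  decoAt-step (Parr s n) [] = refl
  decoAt-step (Parr s n) (inside ∷ p) = refl
  decoAt-step (Parr s n) (left ∷ p) = refl
  decoAt-step (Parr s n) (right ∷ p) = decoAt-step s p
  decoAt-step (Syn s t c) [] = refl
  decoAt-step (Syn s t c) (inside ∷ p) = refl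
  decoAt-step (Syn {P₁ = P₁} s t c) (left ∷ p) = decoAt-enr'-repaint P₁ (step-fits s) (decoAt-step s) p
  decoAt-step (Syn {P₂ = P₂} s t c) (right ∷ p) = decoAt-enr'-repaint P₂ (step-fits t) (decoAt-step t) p

  step-fresh : ∀ {P θ P' p} → P ─[ θ ]→ P' → Leaf θ p → decoAt P p ≡ nothing
  step-fresh (Actf i) ev = refl
  step-fresh (Actp s) (pfx l) = step-fresh s l
  step-fresh (Chol s i) (cl l) = step-fresh s l
  step-fresh (Chor s i) (cr l) = step-fresh s l
  step-fresh (Parl s n) (pl l) = step-fresh s l
  step-fresh (Parr s n) (pr l) = step-fresh s l
  step-fresh (Syn s t c) (synˡ l) = step-fresh s l
  step-fresh (Syn s t c) (synʳ l) = step-fresh t l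

  prefix : A → Maybe Deco → Proc → Proc
  prefix a nothing P = pre a P
  prefix a (just ξ) P = done a ξ P

  rebuild : Proc → (Pos → Maybe Deco) → Proc
  rebuild 𝟘 d = 𝟘
  rebuild (pre a Q) d = prefix a (d []) (rebuild Q (d ∘ (inside ∷_)))
  rebuild (done a ξ Q) d = prefix a (d []) (rebuild Q (d ∘ (inside ∷_)))
  rebuild (Q₁ ⊕ Q₂) d = rebuild Q₁ (d ∘ (left ∷_)) ⊕ rebuild Q₂ (d ∘ (right ∷_))
  rebuild (par L Q₁ Q₂) d = par L (rebuild Q₁ (d ∘ (left ∷_))) (rebuild Q₂ (d ∘ (right ∷_)))

  rebuild-cong : ∀ Q {d d'} → d ≗ d' → rebuild Q d ≡ rebuild Q d'
  rebuild-cong 𝟘 d≗d' = refl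
  rebuild-cong (pre a Q) d≗d' = cong₂ (prefix a) (d≗d' []) (rebuild-cong Q (d≗d' ∘ (inside ∷_)))
  rebuild-cong (done a ξ Q) d≗d' = cong₂ (prefix a) (d≗d' []) (rebuild-cong Q (d≗d' ∘ (inside ∷_)))
  rebuild-cong (Q₁ ⊕ Q₂) d≗d' =
    cong₂ _⊕_ (rebuild-cong Q₁ (d≗d' ∘ (left ∷_))) (rebuild-cong Q₂ (d≗d' ∘ (right ∷_)))
  rebuild-cong (par L Q₁ Q₂) d≗d' =
    cong₂ (par L) (rebuild-cong Q₁ (d≗d' ∘ (left ∷_))) (rebuild-cong Q₂ (d≗d' ∘ (right ∷_)))

  rebuild-decoAt : ∀ P → rebuild (toinitial P) (decoAt P) ≡ P
  rebuild-decoAt 𝟘 = refl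
  rebuild-decoAt (pre a P) = cong (pre a) (rebuild-decoAt P)
  rebuild-decoAt (done a ξ P) = cong (done a ξ) (rebuild-decoAt P)
  rebuild-decoAt (P ⊕ Q) = cong₂ _⊕_ (rebuild-decoAt P) (rebuild-decoAt Q)
  rebuild-decoAt (par L P Q) = cong₂ (par L) (rebuild-decoAt P) (rebuild-decoAt Q)

  toinitial-decoAt-injective : ∀ {P P'} → toinitial P ≡ toinitial P' → decoAt P ≗ decoAt P' → P ≡ P'
  toinitial-decoAt-injective {P} {P'} ti≡ d≗ = begin
    P                                     ≡⟨ rebuild-decoAt P ⟨
    rebuild (toinitial P) (decoAt P)      ≡⟨ rebuild-cong (toinitial P) d≗ ⟩
    rebuild (toinitial P) (decoAt P')     ≡⟨ cong (λ Q → rebuild Q (decoAt P')) ti≡ ⟩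
    rebuild (toinitial P') (decoAt P')    ≡⟨ rebuild-decoAt P' ⟩
    P'                                    ∎
    where open ≡-Reasoning

  -- Events are determined by the decorations they leave

  depth : PT → ℕ
  depth (ev a) = 0
  depth (pfx a θ) = suc (depth θ)
  depth (cl θ) = suc (depth θ)
  depth (cr θ) = suc (depth θ)
  depth (pl L θ) = suc (depth θ)
  depth (pr L θ) = suc (depth θ)
  depth (syn L θ₁ θ₂) = 0

  height : PT → ℕ
  height (ev a) = 0
  height (pfx a θ) = suc (height θ)
  height (cl θ) = suc (height θ)
  height (cr θ) = suc (height θ)
  height (pl L θ) = suc (height θ)
  height (pr L θ) = suc (height θ)
  height (syn L θ₁ θ₂) = suc (height θ₁ ⊓ height θ₂)

  height-≤ : ∀ {θ p} → Leaf θ p → height θ ≤ length p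
  height-≤ ev = z≤n
  height-≤ (pfx l) = s≤s (height-≤ l)
  height-≤ (cl l) = s≤s (height-≤ l)
  height-≤ (cr l) = s≤s (height-≤ l)
  height-≤ (pl l) = s≤s (height-≤ l)
  height-≤ (pr l) = s≤s (height-≤ l)
  height-≤ (synˡ {θ₁ = θ₁} {θ₂} l) = s≤s (≤-trans (m⊓n≤m (height θ₁) (height θ₂)) (height-≤ l))
  height-≤ (synʳ {θ₁ = θ₁} {θ₂} l) = s≤s (≤-trans (m⊓n≤n (height θ₁) (height θ₂)) (height-≤ l))

  shortest-leaf : ∀ θ → Σ Pos λ p → Leaf θ p × length p ≡ height θ
  shortest-leaf (ev a) = [] , ev , refl
  shortest-leaf (pfx a θ) with shortest-leaf θ
  ... | p , l , eq = inside ∷ p , pfx l , cong suc eq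
  shortest-leaf (cl θ) with shortest-leaf θ
  ... | p , l , eq = left ∷ p , cl l , cong suc eq
  shortest-leaf (cr θ) with shortest-leaf θ
  ... | p , l , eq = right ∷ p , cr l , cong suc eq
  shortest-leaf (pl L θ) with shortest-leaf θ
  ... | p , l , eq = left ∷ p , pl l , cong suc eq
  shortest-leaf (pr L θ) with shortest-leaf θ
  ... | p , l , eq = right ∷ p , pr l , cong suc eq
  shortest-leaf (syn L θ₁ θ₂) with ⊓-sel (height θ₁) (height θ₂)
  ... | inj₁ eq₁ = let p , l , eq = shortest-leaf θ₁ in left ∷ p , synˡ l , cong suc (trans eq (sym eq₁))
  ... | inj₂ eq₂ = let p , l , eq = shortest-leaf θ₂ in right ∷ p , synʳ l , cong suc (trans eq (sym eq₂))

  rank : Deco → ℕ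
  rank ε = 0
  rank (deco L θ₁ θ₂) = height (syn L θ₁ θ₂)

  depth+rank-≤ : ∀ {θ p} → Leaf θ p → depth θ + rank (stamp θ) ≤ length p
  depth+rank-≤ ev = z≤n
  depth+rank-≤ (pfx l) = s≤s (depth+rank-≤ l)
  depth+rank-≤ (cl l) = s≤s (depth+rank-≤ l)
  depth+rank-≤ (cr l) = s≤s (depth+rank-≤ l)
  depth+rank-≤ (pl l) = s≤s (depth+rank-≤ l)
  depth+rank-≤ (pr l) = s≤s (depth+rank-≤ l)
  depth+rank-≤ l@(synˡ _) = height-≤ l
  depth+rank-≤ l@(synʳ _) = height-≤ l

  depth+rank≡height : ∀ θ → depth θ + rank (stamp θ) ≡ height θ
  depth+rank≡height (ev a) = refl
  depth+rank≡height (pfx a θ) = cong suc (depth+rank≡height θ)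
  depth+rank≡height (cl θ) = cong suc (depth+rank≡height θ)
  depth+rank≡height (cr θ) = cong suc (depth+rank≡height θ)
  depth+rank≡height (pl L θ) = cong suc (depth+rank≡height θ)
  depth+rank≡height (pr L θ) = cong suc (depth+rank≡height θ)
  depth+rank≡height (syn L θ₁ θ₂) = refl

  depth-≤-at-shortest-leaf : ∀ {θ θ' p} → Leaf θ' p → length p ≡ height θ → stamp θ' ≡ stamp θ →
                             depth θ' ≤ depth θ
  depth-≤-at-shortest-leaf {θ} {θ'} {p} l' |p|≡ stamp≡ = +-cancelʳ-≤ (rank (stamp θ)) _ _ (begin
    depth θ' + rank (stamp θ)    ≡⟨ cong (λ ξ → depth θ' + rank ξ) stamp≡ ⟨
    depth θ' + rank (stamp θ')   ≤⟨ depth+rank-≤ l' ⟩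
    length p                     ≡⟨ |p|≡ ⟩
    height θ                     ≡⟨ depth+rank≡height θ ⟨
    depth θ + rank (stamp θ)     ∎)
    where open ≤-Reasoning

  leaf-stamp-depth-injective : ∀ {Q θ θ' p} → Valid Q θ → Valid Q θ' → Leaf θ p → Leaf θ' p →
                               stamp θ ≡ stamp θ' → depth θ ≡ depth θ' → θ ≡ θ'
  leaf-stamp-depth-injective ev ev _ _ _ _ = refl
  leaf-stamp-depth-injective (pfx v) (pfx v') (pfx l) (pfx l') s d =
    cong (pfx _) (leaf-stamp-depth-injective v v' l l' s (suc-injective d))
  leaf-stamp-depth-injective (cl v) (cl v') (cl l) (cl l') s d =
    cong cl (leaf-stamp-depth-injective v v' l l' s (suc-injective d))
  leaf-stamp-depth-injective (cr v) (cr v') (cr l) (cr l') s d =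
    cong cr (leaf-stamp-depth-injective v v' l l' s (suc-injective d))
  leaf-stamp-depth-injective (pl v) (pl v') (pl l) (pl l') s d =
    cong (pl _) (leaf-stamp-depth-injective v v' l l' s (suc-injective d))
  leaf-stamp-depth-injective (pr v) (pr v') (pr l) (pr l') s d =
    cong (pr _) (leaf-stamp-depth-injective v v' l l' s (suc-injective d))
  leaf-stamp-depth-injective (syn _ _) (syn _ _) _ _ refl _ = refl
  leaf-stamp-depth-injective (pl _) (syn _ _) _ _ _ ()
  leaf-stamp-depth-injective (pr _) (syn _ _) _ _ _ ()
  leaf-stamp-depth-injective (syn _ _) (pl _) _ _ _ ()
  leaf-stamp-depth-injective (syn _ _) (pr _) _ _ _ ()
  leaf-stamp-depth-injective (pl _) (pr _) (pl _) ()
  leaf-stamp-depth-injective (pr _) (pl _) (pr _) ()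
  leaf-stamp-depth-injective (cl _) (cr _) (cl _) ()
  leaf-stamp-depth-injective (cr _) (cl _) (cr _) ()
  leaf-stamp-depth-injective ev (pfx _) ev ()
  leaf-stamp-depth-injective (pfx _) ev (pfx _) ()

  Disjoint : List PT → Set₁
  Disjoint S = ∀ {e e' p} → e ∈ S → e' ∈ S → Leaf e p → Leaf e' p → e ≡ e'

  AllValid : Proc → List PT → Set₁
  AllValid Q S = ∀ {e} → e ∈ S → Valid Q e

  decoOf : List PT → Pos → Maybe Deco
  decoOf [] _ = nothing
  decoOf (e ∷ S) = paint e (stamp e) (decoOf S)

  decoOf-∈ : ∀ {S e p} → Disjoint S → e ∈ S → Leaf e p → decoOf S p ≡ just (stamp e)
  decoOf-∈ {e' ∷ S} {p = p} dS e∈S l with leaf? e' p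
  ... | yes l' = cong (just ∘ stamp) (dS (here refl) e∈S l' l)
  ... | no ¬l' with e∈S
  ...   | here refl = contradiction l ¬l'
  ...   | there e∈S' = decoOf-∈ (λ m m' → dS (there m) (there m')) e∈S' l

  decoOf-just : ∀ {S p ξ} → decoOf S p ≡ just ξ → Σ PT λ e → e ∈ S × Leaf e p × stamp e ≡ ξ
  decoOf-just {e ∷ S} {p} eq with leaf? e p
  ... | yes l = e , here refl , l , just-injective eq
  ... | no _ = let e' , e'∈S , l , s = decoOf-just eq in e' , there e'∈S , l , s

  decoOf-mono : ∀ {S S' p ξ} → Disjoint S' → S ⊆ S' → decoOf S p ≡ just ξ → decoOf S' p ≡ just ξ
  decoOf-mono dS' S⊆S' eq with decoOf-just eq
  ... | e , e∈S , l , refl = decoOf-∈ dS' (S⊆S' e∈S) l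

  decoOf-≋ : ∀ {S S'} → Disjoint S → Disjoint S' → S ≋ S' → decoOf S ≗ decoOf S'
  decoOf-≋ {S} {S'} dS dS' (S⊆S' , S'⊆S) p with decoOf S p in eq
  ... | just ξ = sym (decoOf-mono dS' S⊆S' eq)
  ... | nothing with decoOf S' p in eq'
  ...   | just ξ = case trans (sym (decoOf-mono dS S'⊆S eq')) eq of λ ()
  ...   | nothing = refl

  -- The event of S' owning e's shortest leaf has e's stamp, so it is at most as deep as e:
  -- if shallower it lies in S by induction and is e by disjointness, otherwise it is e outright.
  ∈-transfer : ∀ {Q S S'} → AllValid Q S → AllValid Q S' → Disjoint S → decoOf S ≗ decoOf S' →
               ∀ {e} → (∀ {e'} → depth e' < depth e → e' ∈ S' → e' ∈ S) → e ∈ S → e ∈ S'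
  ∈-transfer vS vS' dS same {e} shallower∈ e∈S with shortest-leaf e
  ... | p , l , |p|≡ with decoOf-just (trans (sym (same p)) (decoOf-∈ dS e∈S l))
  ... | e' , e'∈S' , l' , stamp≡ with m≤n⇒m<n∨m≡n (depth-≤-at-shortest-leaf l' |p|≡ stamp≡)
  ... | inj₁ shallower = subst (_∈ _) (dS (shallower∈ shallower e'∈S') e∈S l' l) e'∈S'
  ... | inj₂ same-depth =
    subst (_∈ _) (leaf-stamp-depth-injective (vS' e'∈S') (vS e∈S) l' l stamp≡ same-depth) e'∈S'

  decoOf-injective : ∀ {Q S S'} → AllValid Q S → AllValid Q S' → Disjoint S → Disjoint S' →
                     decoOf S ≗ decoOf S' → S ⊆ S'
  decoOf-injective {S = S} {S'} vS vS' dS dS' same {e} = proj₁ (both (suc (depth e)) ≤-refl)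
    where
    both : ∀ n {e} → depth e < n → (e ∈ S → e ∈ S') × (e ∈ S' → e ∈ S)
    both (suc n) (s≤s d≤n) =
      ∈-transfer vS vS' dS same (λ lt → proj₂ (both n (<-≤-trans lt d≤n))) ,
      ∈-transfer vS' vS dS' (sym ∘ same) (λ lt → proj₁ (both n (<-≤-trans lt d≤n)))

  -- Histories

  record History (S : List PT) (P : Proc) : Set₁ where
    field
      valid       : AllValid (toinitial P) S
      disjoint    : Disjoint S
      decorations : decoAt P ≗ decoOf S
  open History

  history-initial : ∀ {Q} → Initial Q → History [] Q
  history-initial i = record { valid = λ () ; disjoint = λ () ; decorations = decoAt-initial i }

  step-leaves-fresh : ∀ {S P θ P' e p} → History S P → P ─[ θ ]→ P' → e ∈ S → Leaf θ p → ¬ Leaf e p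
  step-leaves-fresh {p = p} h s e∈S l l' =
    case trans (sym (step-fresh s l)) (trans (decorations h p) (decoOf-∈ (disjoint h) e∈S l')) of λ ()

  step-new : ∀ {S P θ P'} → History S P → P ─[ θ ]→ P' → θ ∉ S
  step-new h s θ∈S = let _ , l , _ = shortest-leaf _ in step-leaves-fresh h s θ∈S l l

  history-step : ∀ {S P θ P'} → History S P → P ─[ θ ]→ P' → History (θ ∷ S) P'
  history-step {S} {P} {θ} {P'} h s = record
    { valid = λ where (here refl) → subst (λ Q → Valid Q θ) ti≡ (step-valid s)
                      (there e∈S) → subst (λ Q → Valid Q _) ti≡ (valid h e∈S)
    ; disjoint = disjoint′
    ; decorations = λ p → trans (decoAt-step s p) (paint-cong θ (stamp θ) (decorations h) p)
    }
    where
    ti≡ : toinitial P ≡ toinitial P'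
    ti≡ = step-toinitial s
    disjoint′ : Disjoint (θ ∷ S)
    disjoint′ (here refl) (here refl) _ _ = refl
    disjoint′ (here refl) (there e'∈S) l l' = ⊥-elim (step-leaves-fresh h s e'∈S l l')
    disjoint′ (there e∈S) (here refl) l l' = ⊥-elim (step-leaves-fresh h s e∈S l' l)
    disjoint′ (there e∈S) (there e'∈S) l l' = disjoint h e∈S e'∈S l l'

  history-≋ : ∀ {S S' P} → History S P → S ≋ S' → History S' P
  history-≋ h (S⊆S' , S'⊆S) = record
    { valid = valid h ∘ S'⊆S
    ; disjoint = disjoint′
    ; decorations = λ p → trans (decorations h p) (decoOf-≋ (disjoint h) disjoint′ (S⊆S' , S'⊆S) p)
    }
    where
    disjoint′ : Disjoint _
    disjoint′ e∈S' e'∈S' = disjoint h (S'⊆S e∈S') (S'⊆S e'∈S')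

  history-along : ∀ {S P Xs P'} → History S P → Trace P Xs P' → History (Xs ʳ++ S) P'
  history-along h nil = h
  history-along h (cons s T) = history-along (history-step h s) T

  histories-⊆ : ∀ {S S' P} → History S P → History S' P → S ⊆ S'
  histories-⊆ h h' = decoOf-injective (valid h) (valid h') (disjoint h) (disjoint h')
                                         (λ p → trans (sym (decorations h p)) (decorations h' p))

  history-determines : ∀ {S P P'} → History S P → History S P' → toinitial P ≡ toinitial P' → P ≡ P'
  history-determines h h' ti≡ =
    toinitial-decoAt-injective ti≡ (λ p → trans (decorations h p) (sym (decorations h' p)))

  -- Runs of decoration-free transitions

  infixl 5 _▷_
  data Run (Q : Proc) : List PT → Proc → Set₁ where
    start : Run Q [] Q
    _▷_   : ∀ {X R θ R'} → Run Q X R → R ─[ θ ]→ˢ R' → Run Q (θ ∷ X) R'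

  run-along : ∀ {Q S P Xs P'} → Run Q S (skeleton P) → Trace P Xs P' → Run Q (Xs ʳ++ S) (skeleton P')
  run-along T nil = T
  run-along T (cons s Tr) = run-along (T ▷ step-skeleton s) Tr

  run-[] : ∀ {Q R} → Run Q [] R → R ≡ Q
  run-[] start = refl

  run-initial : ∀ {Q X R} → Run Q X R → Initial R → X ≡ [] × R ≡ Q
  run-initial start _ = refl , refl
  run-initial (T ▷ s) i = ⊥-elim (stepˢ-non-initial s i)

  run-toinitial : ∀ {Q X R} → Initial Q → Run Q X R → toinitial R ≡ Q
  run-toinitial i start = toinitial-initial i
  run-toinitial i (T ▷ s) = trans (sym (stepˢ-toinitial s)) (run-toinitial i T)

  run-events : ∀ {Q X R e} → Initial Q → Run Q X R → e ∈ X → Ev (scs Q) e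
  run-events i (T ▷ s) (here refl) = subst (λ Q → Ev (scs Q) _) (run-toinitial i T) (stepˢ-event s)
  run-events i (T ▷ s) (there e∈X) = run-events i T e∈X

  run-history : ∀ {Q X R} → Initial Q → Run Q X R → Σ Proc λ P → History X P × skeleton P ≡ R
  run-history i start = _ , history-initial i , skeleton-initial i
  run-history i (T ▷ s) with run-history i T
  ... | P , h , refl with lift P s
  ...   | P' , s' , sk≡ = P' , history-step h s' , sk≡

  run-fresh : ∀ {Q X R θ R'} → Initial Q → Run Q X R → R ─[ θ ]→ˢ R' → θ ∉ X
  run-fresh i T s with run-history i T
  ... | P , h , refl = step-new h (proj₁ (proj₂ (lift P s)))

  run-𝟘 : ∀ {X R} → Run 𝟘 X R → X ≡ [] × R ≡ 𝟘
  run-𝟘 start = refl , refl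
  run-𝟘 (T ▷ s) with run-𝟘 T | s
  ... | refl , refl | ()

  data PreRun (a : A) (Q : Proc) : List PT → Proc → Set₁ where
    idle  : PreRun a Q [] (pre a Q)
    fired : ∀ {Z R} → Run Q Z R → PreRun a Q (map (pfx a) Z ∷ʳ ev a) (done a ε R)

  run-pre : ∀ {a Q X R} → Run (pre a Q) X R → PreRun a Q X R
  run-pre start = idle
  run-pre (T ▷ s) with run-pre T | s
  ... | idle | Actf _ = fired start
  ... | fired T' | Actp s' = fired (T' ▷ s')

  data SumRun (Q₁ Q₂ : Proc) : List PT → Proc → Set₁ where
    viaˡ : ∀ {Z R} → Run Q₁ Z R → SumRun Q₁ Q₂ (map cl Z) (R ⊕ Q₂)
    viaʳ : ∀ {Z R} → Run Q₂ Z R → SumRun Q₁ Q₂ (map cr Z) (Q₁ ⊕ R)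

  run-⊕ : ∀ {Q₁ Q₂ X R} → Run (Q₁ ⊕ Q₂) X R → SumRun Q₁ Q₂ X R
  run-⊕ start = viaˡ start
  run-⊕ (T ▷ s) with run-⊕ T | s
  ... | viaˡ T₁ | Chol s' _ = viaˡ (T₁ ▷ s')
  ... | viaʳ T₂ | Chor s' _ = viaʳ (T₂ ▷ s')
  ... | viaˡ T₁ | Chor s' i with run-initial T₁ i
  ...   | refl , refl = viaʳ (start ▷ s')
  run-⊕ (T ▷ s) | viaʳ T₂ | Chol s' i with run-initial T₂ i
  ...   | refl , refl = viaˡ (start ▷ s')

  data ParRun (L : SyncSet) (Q₁ Q₂ : Proc) (X : List PT) : Proc → Set₁ where
    split : ∀ {R₁ R₂} → Run Q₁ (proj₁ˢ X) R₁ → Run Q₂ (proj₂ˢ X) R₂ → ParRun L Q₁ Q₂ X (par L R₁ R₂)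

  run-par : ∀ {L Q₁ Q₂ X R} → Run (par L Q₁ Q₂) X R → ParRun L Q₁ Q₂ X R
  run-par start = split start start
  run-par (T ▷ s) with run-par T | s
  ... | split T₁ T₂ | Parl s' _ = split (T₁ ▷ s') T₂
  ... | split T₁ T₂ | Parr s' _ = split T₁ (T₂ ▷ s')
  ... | split T₁ T₂ | Syn s' t' _ = split (T₁ ▷ s') (T₂ ▷ t')

  ≋-refl : ∀ {X} → X ≋ X
  ≋-refl = (λ m → m) , (λ m → m)

  ≋-sym : ∀ {X Y} → X ≋ Y → Y ≋ X
  ≋-sym (X⊆Y , Y⊆X) = Y⊆X , X⊆Y

  ≋-trans : ∀ {X Y Z} → X ≋ Y → Y ≋ Z → X ≋ Z
  ≋-trans (X⊆Y , Y⊆X) (Y⊆Z , Z⊆Y) = Y⊆Z ∘ X⊆Y , Y⊆X ∘ Z⊆Y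

  ↭⇒≋ : ∀ {X Y} → X ↭ Y → X ≋ Y
  ↭⇒≋ X↭Y = ∈-resp-↭ X↭Y , ∈-resp-↭ (↭-sym X↭Y)

  ∷ʳ-≋ : ∀ {X x} → (X ∷ʳ x) ≋ (x ∷ X)
  ∷ʳ-≋ {X} {x} = ↭⇒≋ (↭-sym (∷↭∷ʳ x X))

  ∈-≋ : ∀ {X Y x} → X ≋ Y → x ∈ X ⇔ x ∈ Y
  ∈-≋ (X⊆Y , Y⊆X) = mk⇔ X⊆Y Y⊆X

  ∈-map-injective : ∀ (f : PT → PT) → (∀ {x y} → f x ≡ f y → x ≡ y) → ∀ {y Z} → f y ∈ map f Z ⇔ y ∈ Z
  ∈-map-injective f f-inj {Z = Z} =
    mk⇔ (λ m → let z , z∈Z , eq = ∈-map⁻ f m in subst (_∈ Z) (sym (f-inj eq)) z∈Z) (∈-map⁺ f)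

  record Extends (X : List PT) (θ : PT) (Y : List PT) : Set₁ where
    field
      old-⊆    : X ⊆ Y
      new-∈    : θ ∈ Y
      new-∉    : θ ∉ X
      only-new : ∀ {e} → e ∈ Y → e ∉ X → e ≡ θ
  open Extends

  extends-≋ : ∀ {X X' θ Y} → X ≋ X' → Extends X θ Y → Extends X' θ Y
  extends-≋ (X⊆X' , X'⊆X) ext = record
    { old-⊆ = old-⊆ ext ∘ X'⊆X
    ; new-∈ = new-∈ ext
    ; new-∉ = new-∉ ext ∘ X'⊆X
    ; only-new = λ e∈Y e∉X' → only-new ext e∈Y (e∉X' ∘ X⊆X')
    }

  extends-preimage : ∀ (f : PT → PT) → (∀ {x y} → f x ≡ f y → x ≡ y) →
                     ∀ {X Y Zs Z θ} → (∀ {y} → f y ∈ X ⇔ y ∈ Zs) → (∀ {y} → f y ∈ Y ⇔ y ∈ Z) →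
                     Extends X (f θ) Y → Extends Zs θ Z
  extends-preimage f f-inj X-preimage Y-preimage ext = record
    { old-⊆ = to Y-preimage ∘ old-⊆ ext ∘ from X-preimage
    ; new-∈ = to Y-preimage (new-∈ ext)
    ; new-∉ = new-∉ ext ∘ from X-preimage
    ; only-new = λ z∈Z z∉Zs → f-inj (only-new ext (from Y-preimage z∈Z) (z∉Zs ∘ to X-preimage))
    }
    where open Equivalence

  extends-∷-⊆ : ∀ {X θ Y} → Extends X θ Y → (θ ∷ X) ⊆ Y
  extends-∷-⊆ ext (here refl) = new-∈ ext
  extends-∷-⊆ ext (there e∈X) = old-⊆ ext e∈X

  -- Membership in X is undecidable (sync sets are arbitrary predicates), so decide instead
  -- whether some event of θ ∷ X owns e's shortest leaf.
  extends-⊆-∷ : ∀ {X θ Y} → Disjoint Y → Extends X θ Y → Y ⊆ (θ ∷ X)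
  extends-⊆-∷ {X} {θ} dY ext {e} e∈Y with shortest-leaf e
  ... | p , l , _ with any? (λ e' → leaf? e' p) (θ ∷ X)
  ... | yes leaf-at-p = let e' , e'∈θX , l' = find leaf-at-p in
                        subst (_∈ θ ∷ X) (dY (extends-∷-⊆ ext e'∈θX) e∈Y l' l) e'∈θX
  ... | no no-leaf-at-p =
    ⊥-elim (no-leaf-at-p (lose (here (only-new ext e∈Y λ e∈X → no-leaf-at-p (there (lose e∈X l)))) l))

  module Projection (π : List PT → List PT) (π-[] : π [] ≡ [])
                    (π-∷ : ∀ e X → π (e ∷ X) ≡ π (e ∷ []) ++ π X)
                    (π-single : ∀ {x} e → x ∈ π (e ∷ []) → π (e ∷ []) ≡ x ∷ []) where

    ∈-π⁻ : ∀ {x} X → x ∈ π X → Σ PT λ e → e ∈ X × x ∈ π (e ∷ [])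
    ∈-π⁻ [] x∈ = case subst (_ ∈_) π-[] x∈ of λ ()
    ∈-π⁻ (e ∷ X) x∈ with ∈-++⁻ (π (e ∷ [])) (subst (_ ∈_) (π-∷ e X) x∈)
    ... | inj₁ x∈e = e , here refl , x∈e
    ... | inj₂ x∈X = let e' , e'∈X , x∈e' = ∈-π⁻ X x∈X in e' , there e'∈X , x∈e'

    ∈-π⁺ : ∀ {x e X} → e ∈ X → x ∈ π (e ∷ []) → x ∈ π X
    ∈-π⁺ {X = e ∷ X} (here refl) x∈e = subst (_ ∈_) (sym (π-∷ e X)) (∈-++⁺ˡ x∈e)
    ∈-π⁺ {X = e' ∷ X} (there e∈X) x∈e = subst (_ ∈_) (sym (π-∷ e' X)) (∈-++⁺ʳ (π (e' ∷ [])) (∈-π⁺ e∈X x∈e))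

    π-mono : ∀ {X Y} → X ⊆ Y → π X ⊆ π Y
    π-mono {X} X⊆Y x∈ = let e , e∈X , x∈e = ∈-π⁻ X x∈ in ∈-π⁺ (X⊆Y e∈X) x∈e

    Shared : PT → PT → Set₁
    Shared e e' = π (e ∷ []) ≡ π (e' ∷ []) × π (e ∷ []) ≢ []

    shared-sym : ∀ e e' → Shared e e' → Shared e' e
    shared-sym _ _ (eq , ne) = sym eq , ne ∘ trans eq

    fresh-unshared : ∀ θ {e X} → (∀ {x} → x ∈ π (θ ∷ []) → x ∉ π X) → e ∈ X → ¬ Shared θ e
    fresh-unshared θ fresh e∈X (eq , ne) with π (θ ∷ [])
    ... | [] = ne refl
    ... | x ∷ _ = fresh (here refl) (∈-π⁺ e∈X (subst (x ∈_) eq (here refl)))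

    extends-π : ∀ {X θ Y x} → (∀ {e e'} → e ∈ Y → e' ∈ Y → Shared e e' → e ≡ e') →
                Extends X θ Y → x ∈ π (θ ∷ []) → Extends (π X) x (π Y)
    extends-π {X} {θ} {Y} {x} uY ext x∈θ = record
      { old-⊆ = π-mono (old-⊆ ext)
      ; new-∈ = ∈-π⁺ (new-∈ ext) x∈θ
      ; new-∉ = λ x∈X → let e , e∈X , x∈e = ∈-π⁻ X x∈X in
                new-∉ ext (subst (_∈ X) (uY (old-⊆ ext e∈X) (new-∈ ext) (shares x∈e)) e∈X)
      ; only-new = λ {x'} x'∈Y x'∉X → let e , e∈Y , x'∈e = ∈-π⁻ Y x'∈Y in
                   only-child (subst (λ e → x' ∈ π (e ∷ []))
                                     (only-new ext e∈Y λ e∈X → x'∉X (∈-π⁺ e∈X x'∈e)) x'∈e)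
      }
      where
      shares : ∀ {e} → x ∈ π (e ∷ []) → Shared e θ
      shares x∈e = trans (π-single _ x∈e) (sym (π-single θ x∈θ)) ,
                   λ eq → case trans (sym (π-single _ x∈e)) eq of λ ()
      only-child : ∀ {x'} → x' ∈ π (θ ∷ []) → x' ≡ x
      only-child x'∈θ with subst (_ ∈_) (π-single θ x∈θ) x'∈θ
      ... | here eq = eq

  proj₁ˢ-∷ : ∀ e X → proj₁ˢ (e ∷ X) ≡ proj₁ˢ (e ∷ []) ++ proj₁ˢ X
  proj₁ˢ-∷ (ev a) X = refl
  proj₁ˢ-∷ (pfx a e) X = refl
  proj₁ˢ-∷ (cl e) X = refl
  proj₁ˢ-∷ (cr e) X = refl
  proj₁ˢ-∷ (pl L e) X = refl
  proj₁ˢ-∷ (pr L e) X = refl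
  proj₁ˢ-∷ (syn L e₁ e₂) X = refl

  proj₂ˢ-∷ : ∀ e X → proj₂ˢ (e ∷ X) ≡ proj₂ˢ (e ∷ []) ++ proj₂ˢ X
  proj₂ˢ-∷ (ev a) X = refl
  proj₂ˢ-∷ (pfx a e) X = refl
  proj₂ˢ-∷ (cl e) X = refl
  proj₂ˢ-∷ (cr e) X = refl
  proj₂ˢ-∷ (pl L e) X = refl
  proj₂ˢ-∷ (pr L e) X = refl
  proj₂ˢ-∷ (syn L e₁ e₂) X = refl

  proj₁ˢ-single : ∀ {x} e → x ∈ proj₁ˢ (e ∷ []) → proj₁ˢ (e ∷ []) ≡ x ∷ []
  proj₁ˢ-single (pl L e) (here refl) = refl
  proj₁ˢ-single (syn L e₁ e₂) (here refl) = refl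

  proj₂ˢ-single : ∀ {x} e → x ∈ proj₂ˢ (e ∷ []) → proj₂ˢ (e ∷ []) ≡ x ∷ []
  proj₂ˢ-single (pr L e) (here refl) = refl
  proj₂ˢ-single (syn L e₁ e₂) (here refl) = refl

  module Left = Projection proj₁ˢ refl proj₁ˢ-∷ proj₁ˢ-single

  module Right = Projection proj₂ˢ refl proj₂ˢ-∷ proj₂ˢ-single

  -- Runs yield configurations

  Unique : List PT → Set₁
  Unique X = ∀ {e e'} → e ∈ X → e' ∈ X → Left.Shared e e' ⊎ Right.Shared e e' → e ≡ e'

  Separated : CS → CS → List PT → Set₁
  Separated C₁ C₂ X = ∀ {e e'} → e ∈ X → e' ∈ X → e ≢ e' →
    Σ (List PT) λ Y → Y ⊆ X × Conf C₁ (proj₁ˢ Y) × Conf C₂ (proj₂ˢ Y) × ((e ∈ Y → e' ∉ Y) × (e' ∉ Y → e ∈ Y))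

  RunsConf : Proc → Set₁
  RunsConf Q = ∀ {X R} → Run Q X R → Conf (scs Q) X

  par-step-fresh : ∀ {L Q₁ Q₂ R₁ R₂ X θ R'} → Initial Q₁ → Initial Q₂ →
                   Run Q₁ (proj₁ˢ X) R₁ → Run Q₂ (proj₂ˢ X) R₂ → par L R₁ R₂ ─[ θ ]→ˢ R' →
                   (∀ {x} → x ∈ proj₁ˢ (θ ∷ []) → x ∉ proj₁ˢ X) × (∀ {x} → x ∈ proj₂ˢ (θ ∷ []) → x ∉ proj₂ˢ X)
  par-step-fresh i₁ i₂ T₁ T₂ (Parl s _) = (λ { (here refl) → run-fresh i₁ T₁ s }) , λ ()
  par-step-fresh i₁ i₂ T₁ T₂ (Parr s _) = (λ ()) , λ { (here refl) → run-fresh i₂ T₂ s }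
  par-step-fresh i₁ i₂ T₁ T₂ (Syn s t _) =
    (λ { (here refl) → run-fresh i₁ T₁ s }) , λ { (here refl) → run-fresh i₂ T₂ t }

  par-run-unique : ∀ {L Q₁ Q₂ X R} → Initial Q₁ → Initial Q₂ → Run (par L Q₁ Q₂) X R → Unique X
  par-run-unique i₁ i₂ start ()
  par-run-unique {X = θ ∷ X} i₁ i₂ (T ▷ s) with run-par T
  ... | split T₁ T₂ = unique
    where
    fresh₁ : ∀ {x} → x ∈ proj₁ˢ (θ ∷ []) → x ∉ proj₁ˢ X
    fresh₁ = proj₁ (par-step-fresh {X = X} i₁ i₂ T₁ T₂ s)
    fresh₂ : ∀ {x} → x ∈ proj₂ˢ (θ ∷ []) → x ∉ proj₂ˢ X
    fresh₂ = proj₂ (par-step-fresh {X = X} i₁ i₂ T₁ T₂ s)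
    unique : Unique (θ ∷ X)
    unique (here refl) (here refl) _ = refl
    unique (here refl) (there e'∈X) =
      ⊥-elim ∘ [ Left.fresh-unshared θ fresh₁ e'∈X , Right.fresh-unshared θ fresh₂ e'∈X ]
    unique {e} (there e∈X) (here refl) =
      ⊥-elim ∘ [ Left.fresh-unshared θ fresh₁ e∈X ∘ Left.shared-sym e θ
               , Right.fresh-unshared θ fresh₂ e∈X ∘ Right.shared-sym e θ ]
    unique (there e∈X) (there e'∈X) = par-run-unique i₁ i₂ T e∈X e'∈X

  par-run-separated : ∀ {L Q₁ Q₂ X R} → Initial Q₁ → Initial Q₂ → RunsConf Q₁ → RunsConf Q₂ →
                      Run (par L Q₁ Q₂) X R → Separated (scs Q₁) (scs Q₂) X
  par-run-separated i₁ i₂ c₁ c₂ start ()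
  par-run-separated {X = θ ∷ X} i₁ i₂ c₁ c₂ (T ▷ s) with run-par T
  ... | split T₁ T₂ = λ where
      (here refl) (here refl) θ≢θ → ⊥-elim (θ≢θ refl)
      (here refl) (there e'∈X) _ → X , there , c₁ T₁ , c₂ T₂ , ⊥-elim ∘ θ∉X , λ e'∉X → ⊥-elim (e'∉X e'∈X)
      (there e∈X) (here refl) _ → X , there , c₁ T₁ , c₂ T₂ , (λ _ → θ∉X) , λ _ → e∈X
      (there e∈X) (there e'∈X) e≢e' →
        let Y , Y⊆X , rest = par-run-separated i₁ i₂ c₁ c₂ T e∈X e'∈X e≢e' in Y , there ∘ Y⊆X , rest
    where
    θ∉X : θ ∉ X
    θ∉X = run-fresh (ipar i₁ i₂) T s

  run-conf : ∀ {Q} → Initial Q → RunsConf Q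
  run-conf i𝟘 T with run-𝟘 T
  ... | refl , refl = ≋-refl
  run-conf (ipre i) T with run-pre T
  ... | idle = inj₁ ≋-refl
  ... | fired T' = inj₂ (_ , run-conf i T' , ∷ʳ-≋)
  run-conf (i⊕ i₁ i₂) T with run-⊕ T
  ... | viaˡ T₁ = inj₁ (_ , run-conf i₁ T₁ , ≋-refl)
  ... | viaʳ T₂ = inj₂ (_ , run-conf i₂ T₂ , ≋-refl)
  run-conf (ipar i₁ i₂) T with run-par T
  ... | split T₁ T₂ = run-events (ipar i₁ i₂) T , run-conf i₁ T₁ , run-conf i₂ T₂ ,
                      par-run-unique i₁ i₂ T , par-run-separated i₁ i₂ (run-conf i₁) (run-conf i₂) T

  conf-≋ : ∀ {Q X Y} → Initial Q → Conf (scs Q) X → X ≋ Y → Conf (scs Q) Y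
  conf-≋ i𝟘 X≋[] X≋Y = ≋-trans (≋-sym X≋Y) X≋[]
  conf-≋ (ipre _) (inj₁ X≋[]) X≋Y = inj₁ (≋-trans (≋-sym X≋Y) X≋[])
  conf-≋ (ipre _) (inj₂ (Z , cZ , X≋)) X≋Y = inj₂ (Z , cZ , ≋-trans (≋-sym X≋Y) X≋)
  conf-≋ (i⊕ _ _) (inj₁ (Z , cZ , X≋)) X≋Y = inj₁ (Z , cZ , ≋-trans (≋-sym X≋Y) X≋)
  conf-≋ (i⊕ _ _) (inj₂ (Z , cZ , X≋)) X≋Y = inj₂ (Z , cZ , ≋-trans (≋-sym X≋Y) X≋)
  conf-≋ (ipar i₁ i₂) (evs , c₁ , c₂ , uX , sX) (X⊆Y , Y⊆X) =
    evs ∘ Y⊆X ,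
    conf-≋ i₁ c₁ (Left.π-mono X⊆Y , Left.π-mono Y⊆X) ,
    conf-≋ i₂ c₂ (Right.π-mono X⊆Y , Right.π-mono Y⊆X) ,
    (λ e∈Y e'∈Y → uX (Y⊆X e∈Y) (Y⊆X e'∈Y)) ,
    λ e∈Y e'∈Y e≢e' → let Z , Z⊆X , rest = sX (Y⊆X e∈Y) (Y⊆X e'∈Y) e≢e' in Z , X⊆Y ∘ Z⊆X , rest

  -- Configurations extending a run are enabled

  Enables : Proc → Set₁
  Enables Q = ∀ {X R Y θ} → Run Q X R → Conf (scs Q) Y → Extends X θ Y → Σ Proc (R ─[ θ ]→ˢ_)

  pfx-injective : ∀ {a} {x y : PT} → pfx a x ≡ pfx a y → x ≡ y
  pfx-injective refl = refl

  cl-injective : ∀ {x y : PT} → cl x ≡ cl y → x ≡ y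
  cl-injective refl = refl

  cr-injective : ∀ {x y : PT} → cr x ≡ cr y → x ≡ y
  cr-injective refl = refl

  pfx-∈ : ∀ {a y Z} → pfx a y ∈ ev a ∷ map (pfx a) Z ⇔ y ∈ Z
  pfx-∈ {a} = mk⇔ (λ { (here ()) ; (there m) → Equivalence.to (∈-map-injective (pfx a) pfx-injective) m })
                  (there ∘ ∈-map⁺ (pfx a))

  extends-proj₁ : ∀ {X θ Y x} → Unique Y → Extends X θ Y → x ∈ proj₁ˢ (θ ∷ []) →
                  Extends (proj₁ˢ X) x (proj₁ˢ Y)
  extends-proj₁ uY = Left.extends-π (λ e∈Y e'∈Y → uY e∈Y e'∈Y ∘ inj₁)

  extends-proj₂ : ∀ {X θ Y x} → Unique Y → Extends X θ Y → x ∈ proj₂ˢ (θ ∷ []) →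
                  Extends (proj₂ˢ X) x (proj₂ˢ Y)
  extends-proj₂ uY = Right.extends-π (λ e∈Y e'∈Y → uY e∈Y e'∈Y ∘ inj₂)

  enabled-𝟘 : Enables 𝟘
  enabled-𝟘 _ (Y⊆[] , _) ext = case Y⊆[] (new-∈ ext) of λ ()

  enabled-pre : ∀ {a Q} → Initial Q → Enables Q → Enables (pre a Q)
  enabled-pre i en T (inj₁ (Y⊆[] , _)) ext = case Y⊆[] (new-∈ ext) of λ ()
  enabled-pre i en T (inj₂ (Z , cZ , Y≋)) ext with run-pre T
  ... | idle with only-new ext (proj₂ Y≋ (here refl)) (λ ())
  ...   | refl = _ , Actf i
  enabled-pre {a} i en T (inj₂ (Z , cZ , Y≋)) ext | fired T' with proj₁ Y≋ (new-∈ ext)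
  ...   | here refl = ⊥-elim (new-∉ ext (proj₂ ∷ʳ-≋ (here refl)))
  ...   | there θ∈ with ∈-map⁻ (pfx a) θ∈
  ...     | _ , _ , refl =
    _ , Actp (proj₂ (en T' cZ (extends-preimage (pfx a) pfx-injective
                                 (⇔-trans (∈-≋ ∷ʳ-≋) pfx-∈) (⇔-trans (∈-≋ Y≋) pfx-∈) ext)))

  enabled-⊕ : ∀ {Q₁ Q₂} → Initial Q₁ → Initial Q₂ → Enables Q₁ → Enables Q₂ → Enables (Q₁ ⊕ Q₂)
  enabled-⊕ {Q₁} {Q₂} i₁ i₂ en₁ en₂ T = by-cases (run-⊕ T)
    where
    moveˡ : ∀ {Zs R₁ Z Y θ} → Run Q₁ Zs R₁ → Conf (scs Q₁) Z → Y ≋ map cl Z →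
            Extends (map cl Zs) θ Y → Σ Proc (R₁ ⊕ Q₂ ─[ θ ]→ˢ_)
    moveˡ T₁ cZ Y≋ ext with ∈-map⁻ cl (proj₁ Y≋ (new-∈ ext))
    ... | _ , _ , refl = _ , Chol (proj₂ (en₁ T₁ cZ (extends-preimage cl cl-injective cl-∈
                                                    (⇔-trans (∈-≋ Y≋) cl-∈) ext))) i₂
      where cl-∈ = ∈-map-injective cl cl-injective
    moveʳ : ∀ {Zs R₂ Z Y θ} → Run Q₂ Zs R₂ → Conf (scs Q₂) Z → Y ≋ map cr Z →
            Extends (map cr Zs) θ Y → Σ Proc (Q₁ ⊕ R₂ ─[ θ ]→ˢ_)
    moveʳ T₂ cZ Y≋ ext with ∈-map⁻ cr (proj₁ Y≋ (new-∈ ext))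
    ... | _ , _ , refl = _ , Chor (proj₂ (en₂ T₂ cZ (extends-preimage cr cr-injective cr-∈
                                                    (⇔-trans (∈-≋ Y≋) cr-∈) ext))) i₁
      where cr-∈ = ∈-map-injective cr cr-injective
    by-cases : ∀ {X R Y θ} → SumRun Q₁ Q₂ X R → Conf (scs (Q₁ ⊕ Q₂)) Y → Extends X θ Y →
               Σ Proc (R ─[ θ ]→ˢ_)
    by-cases (viaˡ T₁) (inj₁ (_ , cZ , Y≋)) ext = moveˡ T₁ cZ Y≋ ext
    by-cases (viaʳ T₂) (inj₂ (_ , cZ , Y≋)) ext = moveʳ T₂ cZ Y≋ ext
    by-cases (viaˡ {[]} T₁) (inj₂ (_ , cZ , Y≋)) ext with run-[] T₁
    ... | refl = moveʳ start cZ Y≋ ext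
    by-cases (viaʳ {[]} T₂) (inj₁ (_ , cZ , Y≋)) ext with run-[] T₂
    ... | refl = moveˡ start cZ Y≋ ext
    by-cases (viaˡ {_ ∷ _} _) (inj₂ (_ , _ , Y≋)) ext =
      case ∈-map⁻ cr (proj₁ Y≋ (old-⊆ ext (here refl))) of λ { (_ , _ , ()) }
    by-cases (viaʳ {_ ∷ _} _) (inj₁ (_ , _ , Y≋)) ext =
      case ∈-map⁻ cl (proj₁ Y≋ (old-⊆ ext (here refl))) of λ { (_ , _ , ()) }

  enabled-par : ∀ {L Q₁ Q₂} → Enables Q₁ → Enables Q₂ → Enables (par L Q₁ Q₂)
  enabled-par en₁ en₂ T (evY , c₁ , c₂ , uY , _) ext with run-par T | evY (new-∈ ext)
  ... | split T₁ T₂ | inj₁ (_ , refl , _ , n) =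
    _ , Parl (proj₂ (en₁ T₁ c₁ (extends-proj₁ uY ext (here refl)))) n
  ... | split T₁ T₂ | inj₂ (inj₁ (_ , refl , _ , n)) =
    _ , Parr (proj₂ (en₂ T₂ c₂ (extends-proj₂ uY ext (here refl)))) n
  ... | split T₁ T₂ | inj₂ (inj₂ (_ , _ , refl , _ , _ , c)) =
    _ , Syn (proj₂ (en₁ T₁ c₁ (extends-proj₁ uY ext (here refl))))
            (proj₂ (en₂ T₂ c₂ (extends-proj₂ uY ext (here refl)))) c

  enabled : ∀ {Q} → Initial Q → Enables Q
  enabled i𝟘 = enabled-𝟘
  enabled (ipre i) = enabled-pre i (enabled i)
  enabled (i⊕ i₁ i₂) = enabled-⊕ i₁ i₂ (enabled i₁) (enabled i₂)
  enabled (ipar i₁ i₂) = enabled-par (enabled i₁) (enabled i₂)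

  isXP-trace : ∀ {P X} → IsXP P X → Trace (toinitial P) X P
  isXP-trace {P} (inj₁ (i , refl)) = subst (λ Q → Trace Q [] P) (sym (toinitial-initial i)) nil
  isXP-trace (inj₂ (_ , T)) = T

  isXP-history : ∀ {P X} → IsXP P X → History X P
  isXP-history {P} {X} xp =
    history-≋ (history-along (history-initial (initial-toinitial P)) (isXP-trace xp)) (↭⇒≋ (↭-reverse X))

  isXP-run : ∀ {P X} → IsXP P X → Run (toinitial P) (reverse X) (skeleton P)
  isXP-run {P} xp =
    run-along (subst (Run (toinitial P) []) (sym (skeleton-initial (initial-toinitial P))) start)
              (isXP-trace xp)

  isXP-conf : ∀ {P X} → IsXP P X → Conf C[ P ] X
  isXP-conf {P} {X} xp =
    conf-≋ (initial-toinitial P) (run-conf (initial-toinitial P) (isXP-run xp)) (↭⇒≋ (↭-reverse X))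

  step⇒extends : ∀ {X P X' P' θ} → History X P → History X' P' → P ─[ θ ]→ P' → Extends X θ X'
  step⇒extends h h' s = record
    { old-⊆ = θX⊆X' ∘ there
    ; new-∈ = θX⊆X' (here refl)
    ; new-∉ = step-new h s
    ; only-new = λ e∈X' e∉X → case X'⊆θX e∈X' of λ where
        (here e≡θ) → e≡θ
        (there e∈X) → ⊥-elim (e∉X e∈X)
    }
    where
    θX⊆X' = histories-⊆ (history-step h s) h'
    X'⊆θX = histories-⊆ h' (history-step h s)

  extends⇒conf-transition : ∀ {C X θ a X'} → Conf C X → Conf C X' → Extends X θ X' → act θ ≡ just a →
                            CTransEv C X θ a X'
  extends⇒conf-transition cX cX' ext act≡ =
    cX , cX' , old-⊆ ext , new-∈ ext , new-∉ ext , only-new ext , act≡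

  conf-transition⇒extends : ∀ {C X θ a X'} → CTransEv C X θ a X' → Extends X θ X'
  conf-transition⇒extends (_ , _ , X⊆X' , θ∈X' , θ∉X , only-θ , _) =
    record { old-⊆ = X⊆X' ; new-∈ = θ∈X' ; new-∉ = θ∉X ; only-new = only-θ }

  enabled-step : ∀ {P X θ X'} → IsXP P X → Conf C[ P ] X' → Extends X θ X' → Σ Proc (P ─[ θ ]→_)
  enabled-step {P} {X} xp cX' ext =
    let _ , sˢ = enabled (initial-toinitial P) (isXP-run xp) cX' (extends-≋ (↭⇒≋ (↭-sym (↭-reverse X))) ext)
        P'' , s , _ = lift P sˢ
    in P'' , s

  extension-target : ∀ {X P θ P'' X' P'} → History X P → P ─[ θ ]→ P'' → History X' P' →
                     Extends X θ X' → toinitial P ≡ toinitial P' → P'' ≡ P'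
  extension-target h s h' ext ti≡ =
    history-determines (history-≋ (history-step h s) (extends-∷-⊆ ext , extends-⊆-∷ (disjoint h') ext)) h'
                       (trans (sym (step-toinitial s)) ti≡)

  step⇒conf-transition : ∀ {P P' θ X X'} → toinitial P ≡ toinitial P' → IsXP P X → IsXP P' X' →
                         P ─[ θ ]→ P' → Σ A λ a → CTransEv C[ P ] X θ a X'
  step⇒conf-transition {P} {X' = X'} ti≡ xp xp' s =
    let a , act≡ = stepˢ-act (step-skeleton s)
        cX' = subst (λ Q → Conf (scs Q) X') (sym ti≡) (isXP-conf xp')
        ext = step⇒extends (isXP-history xp) (isXP-history xp') s
    in a , extends⇒conf-transition {C[ P ]} (isXP-conf xp) cX' ext act≡

  conf-transition⇒step : ∀ {P P' θ X X'} → toinitial P ≡ toinitial P' → IsXP P X → IsXP P' X' →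
                         Σ A (λ a → CTransEv C[ P ] X θ a X') → P ─[ θ ]→ P'
  conf-transition⇒step {P} {θ = θ} {X} ti≡ xp xp' (_ , t@(_ , cX' , _)) =
    let ext = conf-transition⇒extends {C[ P ]} t
        P'' , s = enabled-step xp cX' ext
    in subst (P ─[ θ ]→_) (extension-target (isXP-history xp) s (isXP-history xp') ext ti≡) s

lemma4p9 : (A : Set) (_≟_ : DecidableEquality A) (τ : A) →
    let open Theory A _≟_ τ in
    (P P' : Proc) (θ : PT) → Reachable P → Reachable P' →
    toinitial P ≡ toinitial P' →
    (X X' : List PT) → IsXP P X → IsXP P' X' →
    (P ─[ θ ]→ P') ⇔ Σ A (λ a → CTransEv C[ P ] X θ a X')
lemma4p9 A _≟_ τ P P' θ _ _ ti≡ X X' xp xp' =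
  mk⇔ (step⇒conf-transition ti≡ xp xp') (conf-transition⇒step ti≡ xp xp')
  where open Correspondence A _≟_ τ
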